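{- For every positive integer $m\notin\{3,6,7\}$, $$h_2(m)\leq g(\lfloor\log_2m\rfloor),$$ with equality if and only if $m=5$ or $m$ is a power of $2$. In particular, $\limsup_{m\to\infty}h_2(m)=\lambda$.
   Context: $g(k)=\sum_{j=1}^k\frac{2^{j-1}}{2^{2^j}}$ (so $g(0)=0$) and $\lambda=\sum_{j=1}^\infty\frac{2^{j-1}}{2^{2^j}}$. A triangular choice multigraph (TCM) $\mathcal{G}$ on a vertex set $V$ is obtained by choosing, for every 3-element subset $\{u,v,w\}\subseteq V$, exactly one of the pairs $uv,uw,vw$ and adding one copy of it as an edge; $m^{\mathcal{G}}_{xy}$ is the multiplicity of $xy$; for a TCM on $[m]$, $w(\mathcal{G},2)=\sum_{xy\in\binom{[m]}{2}}2^{m^{\mathcal{G}}_{xy}}$. A TCM $\mathcal{G}$ on $V$ is 2-recursive if either $|V|\in\{1,2\}$ and $\mathcal{G}$ is empty, or $|V|\geq 3$ and there is a partition $V=V_1\cup V_2$ with $V_1,V_2\neq\emptyset$ such that $\mathcal{G}=\mathcal{G}_1\cup\mathcal{G}_2\cup\mathcal{G}_3$ (union with multiplicities), where $\mathcal{G}_i$ is a 2-recursive TCM on $V_i$ and $\mathcal{G}_3$ consists of: for every triple with $u,v\in V_1$, $w\in V_2$ a copy of $uv$, and for every triple with $u\in V_1$, $v,w\in V_2$ a copy of $vw$. $H_2(m)$ is the maximum of $w(\mathcal{G},2)$ over all 2-recursive TCMs on $[m]$, and $h_2(m)=H_2(m)/(m2^{m-1})$. -}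

module Defs where

open import Data.Nat using (ℕ; zero; suc; _+_; _*_; _∸_; _^_; _≤_; _<ᵇ_)
open import Data.Nat.Properties using (m^n≢0; m*n≢0)
open import Data.Integer using (+_)
open import Data.Rational using (ℚ; _/_; 0ℚ) renaming (_+_ to _+ℚ_)
open import Data.Fin using (Fin; toℕ)
open import Data.Fin.Subset using (Subset; ∣_∣; _∩_; _∪_; ⊥; ⊤; Nonempty)
open import Data.Vec using (lookup)
open import Data.Bool using (Bool; true; false; if_then_else_; _∧_)
open import Data.List using (List; map; allFin)
open import Data.Nat.ListAction using (sum)
open import Data.Product using (Σ; ∃; _×_)
open import Relation.Binary.PropositionalEquality using (_≡_)

-- g(k) = Σ_{j=1}^k 2^{j-1} / 2^{2^j}   (g 0 = 0), as a rational number

term : ℕ → ℚ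
term j = (+ (2 ^ j)) / (2 ^ (2 ^ suc j))
  where instance _ = m^n≢0 2 (2 ^ suc j)

g : ℕ → ℚ
g zero    = 0ℚ
g (suc k) = g k +ℚ term k

-- Triangular choice multigraphs on [m] = Fin m are represented by their
-- multiplicity function  M x y  (only pairs x < y are relevant).

Mult : ℕ → Set
Mult m = Fin m → Fin m → ℕ

-- The multigraph G₃ of the recursive construction for the partition
-- V = V₁ ∪ V₂ : every pair uv inside V₁ gets one copy for each w ∈ V₂
-- (i.e. ∣V₂∣ copies), every pair vw inside V₂ gets one copy for each
-- u ∈ V₁ (i.e. ∣V₁∣ copies), crossing pairs get none.
cross : ∀ {m} → Subset m → Subset m → Mult m
cross V₁ V₂ x y =
  if lookup V₁ x ∧ lookup V₁ y then ∣ V₂ ∣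
  else (if lookup V₂ x ∧ lookup V₂ y then ∣ V₁ ∣ else 0)

data Rec2 {m : ℕ} : Subset m → Mult m → Set where
  base  : (V : Subset m) → Nonempty V → ∣ V ∣ ≤ 2 → Rec2 V (λ _ _ → 0)
  split : (V V₁ V₂ : Subset m) (M₁ M₂ : Mult m) →
          3 ≤ ∣ V ∣ →
          V₁ ∪ V₂ ≡ V → V₁ ∩ V₂ ≡ ⊥ →
          Nonempty V₁ → Nonempty V₂ →
          Rec2 V₁ M₁ → Rec2 V₂ M₂ →
          Rec2 V (λ x y → M₁ x y + M₂ x y + cross V₁ V₂ x y)

weight : ∀ {m} → Mult m → ℕ
weight {m} M =
  sum (map (λ x → sum (map (λ y → if toℕ x <ᵇ toℕ y then 2 ^ M x y else 0)
                             (allFin m)))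
           (allFin m))

IsH2 : ℕ → ℕ → Set
IsH2 m H = (∃ λ (M : Mult m) → Rec2 ⊤ M × weight M ≡ H)
         × ((M : Mult m) → Rec2 ⊤ M → weight M ≤ H)

-- h₂ value H / (m 2^{m-1}) (for m ≥ 1; the value at m = 0 is irrelevant)
hval : ℕ → ℕ → ℚ
hval zero    H = 0ℚ
hval (suc n) H = (+ H) / (suc n * 2 ^ n)
  where instance _ = m*n≢0 (suc n) (2 ^ n) {{_}} {{m^n≢0 2 n}}

-- Write W(m) = 2 H₂(m).  In a 2-recursive TCM on V₁ ∪ V₂ with |V₁| = a, |V₂| = b, every pair inside V₁
-- gains b edges and every pair inside V₂ gains a, while the ab crossing pairs stay empty, so W(a + b) is the
-- maximum over splits of 2^b W(a) + 2^a W(b) + 2ab.  The claim h₂(m) ≤ g ⌊log₂ m⌋ reads W(m) ≤ m 2^m g ⌊log₂ m⌋,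
-- and this bound (raised to the true values at m = 3, 6, 7) is preserved by the recursion: for m ≤ 15 by a
-- finite computation, for larger m by comparing the levels ⌊log₂⌋ of the parts with that of m, the cross term
-- 2ab being paid for by the increment g (k + 1) − g k = 2^k / 2^(2^(k+1)).  The step is strict when m ≥ 9 is
-- not a power of two, whereas balanced splits of powers of two and the split 5 = 2 + 3 attain the bound.
-- Since g increases to λ, the lim sup of h₂ is λ.

module Submission where

open import Defs
open import Data.Bool.Base using (Bool; true; false; _∧_; _∨_; if_then_else_)
open import Data.Fin.Base using (Fin; zero; suc; toℕ; fromℕ<)
open import Data.Fin.Properties using (all?; toℕ-fromℕ<)
open import Data.Fin.Subset using (Subset; ∣_∣; _∩_; _∪_; ⊥; ⊤; Nonempty)
open import Data.Fin.Subset.Properties using (x∈p⇒∣p-x∣<∣p∣; nonempty?; Empty-unique; ∣⊥∣≡0; ∣⊤∣≡n)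
import Data.Integer.Base as ℤ
import Data.Integer.Properties as ℤ
open import Data.List.Base as List using (allFin)
open import Data.Nat.Base
  using (ℕ; zero; suc; pred; _+_; _*_; _∸_; _^_; _≤_; _<_; z≤n; s≤s; _≡ᵇ_; _<ᵇ_; ⌊_/2⌋; ⌈_/2⌉;
         NonZero; >-nonZero; >-nonZero⁻¹)
import Data.Nat.ListAction as ListAction
open import Data.Nat.Logarithm using (⌊log₂_⌋; ⌊log₂⌋-mono-≤; ⌊log₂⌊n/2⌋⌋≡⌊log₂n⌋∸1; ⌊log₂[2^n]⌋≡n)
open import Data.Nat.Properties
open import Algebra.Properties.Semiring.Sum +-*-semiring
  using (sum; sum-syntax; sum-cong-≗; ∑-distrib-+; ∑-comm; *-distribˡ-sum; *-distribʳ-sum; sum-replicate-zero)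
open import Data.Nat.Tactic.RingSolver using (solve-∀)
open import Data.Product.Base using (∃; _×_; _,_; proj₁; proj₂)
open import Data.Rational.Base as ℚ using (ℚ) renaming (_≤_ to _≤ℚ_; _<_ to _<ℚ_)
import Data.Rational.Properties as ℚ
import Data.Rational.Unnormalised.Base as ℚᵘ
import Data.Rational.Unnormalised.Properties as ℚᵘ
open import Data.Sum.Base using (_⊎_; inj₁; inj₂; [_,_]′)
open import Data.Vec.Base using ([]; _∷_; lookup)
open import Data.Vec.Properties using (lookup-zipWith; lookup-replicate)
open import Function.Base using (_∘_; id)
open import Function.Bundles using (_⇔_; mk⇔; Equivalence)
open import Relation.Binary.PropositionalEquality
open import Relation.Nullary.Decidable using (yes; no; from-yes)
open import Relation.Nullary.Negation using (contradiction)

open ≤-Reasoning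

χ : Bool → ℕ
χ true  = 1
χ false = 0

_<ᶠ_ _=ᶠ_ : ∀ {n} → Fin n → Fin n → Bool
x <ᶠ y = toℕ x <ᵇ toℕ y
x =ᶠ y = toℕ x ≡ᵇ toℕ y

∑² : ∀ {n} → (Fin n → Fin n → ℕ) → ℕ
∑² {n} f = ∑[ x < n ] ∑[ y < n ] f x y

∑²-cong : ∀ {n} {f g : Fin n → Fin n → ℕ} → (∀ x y → f x y ≡ g x y) → ∑² f ≡ ∑² g
∑²-cong f≗g = sum-cong-≗ (λ x → sum-cong-≗ (f≗g x))

∑²-distrib-+ : ∀ {n} (f g : Fin n → Fin n → ℕ) → ∑² (λ x y → f x y + g x y) ≡ ∑² f + ∑² g
∑²-distrib-+ f g = trans (sum-cong-≗ (λ x → ∑-distrib-+ (f x) (g x))) (∑-distrib-+ (λ x → sum (f x)) (λ x → sum (g x)))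

*-distribˡ-∑² : ∀ {n} c (f : Fin n → Fin n → ℕ) → c * ∑² f ≡ ∑² (λ x y → c * f x y)
*-distribˡ-∑² c f = trans (*-distribˡ-sum c (λ x → sum (f x))) (sum-cong-≗ (λ x → *-distribˡ-sum c (f x)))

∑²-product : ∀ {n} (f g : Fin n → ℕ) → ∑² (λ x y → f x * g y) ≡ sum f * sum g
∑²-product f g = sym (trans (*-distribʳ-sum (sum g) f) (sum-cong-≗ (λ x → *-distribˡ-sum (f x) g)))

∑-diagonal : ∀ {n} (x : Fin n) (h : Fin n → ℕ) → ∑[ y < n ] (χ (x =ᶠ y) * h y) ≡ h x
∑-diagonal {suc n} zero    h = begin-equality
  h zero + 0 + ∑[ y < n ] 0 ≡⟨ cong (h zero + 0 +_) (sum-replicate-zero n) ⟩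
  h zero + 0 + 0            ≡⟨ trans (+-identityʳ _) (+-identityʳ _) ⟩
  h zero                    ∎
∑-diagonal {suc n} (suc x) h = ∑-diagonal x (λ y → h (suc y))

<ᶠ-trichotomy : ∀ {n} (x y : Fin n) → χ (x <ᶠ y) + χ (y <ᶠ x) + χ (x =ᶠ y) ≡ 1
<ᶠ-trichotomy zero    zero    = refl
<ᶠ-trichotomy zero    (suc y) = refl
<ᶠ-trichotomy (suc x) zero    = refl
<ᶠ-trichotomy (suc x) (suc y) = <ᶠ-trichotomy x y

∑-ordered-pairs : ∀ {n} (f g : Fin n → ℕ) →
  ∑² (λ x y → χ (x <ᶠ y) * (f x * g y)) + ∑² (λ x y → χ (y <ᶠ x) * (f x * g y))
    + ∑[ x < n ] (f x * g x) ≡ sum f * sum g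
∑-ordered-pairs {n} f g = begin-equality
  ∑² below + ∑² above + ∑[ x < n ] (f x * g x)
    ≡⟨ cong (∑² below + ∑² above +_) (sum-cong-≗ (λ x → sym (∑-diagonal x (λ y → f x * g y)))) ⟩
  ∑² below + ∑² above + ∑² diagonal
    ≡⟨ cong (_+ ∑² diagonal) (∑²-distrib-+ below above) ⟨
  ∑² (λ x y → below x y + above x y) + ∑² diagonal
    ≡⟨ ∑²-distrib-+ (λ x y → below x y + above x y) diagonal ⟨
  ∑² (λ x y → below x y + above x y + diagonal x y)
    ≡⟨ ∑²-cong (λ x y → trans (factor x y) (trans (cong (_* (f x * g y)) (<ᶠ-trichotomy x y)) (*-identityˡ _))) ⟩
  ∑² (λ x y → f x * g y)
    ≡⟨ ∑²-product f g ⟩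
  sum f * sum g ∎
  where
  below above diagonal : Fin n → Fin n → ℕ
  below    x y = χ (x <ᶠ y) * (f x * g y)
  above    x y = χ (y <ᶠ x) * (f x * g y)
  diagonal x y = χ (x =ᶠ y) * (f x * g y)
  factor : ∀ x y → below x y + above x y + diagonal x y
                 ≡ (χ (x <ᶠ y) + χ (y <ᶠ x) + χ (x =ᶠ y)) * (f x * g y)
  factor x y = distrib₃ (χ (x <ᶠ y)) (χ (y <ᶠ x)) (χ (x =ᶠ y)) (f x * g y)
    where
    distrib₃ : ∀ a b c t → a * t + b * t + c * t ≡ (a + b + c) * t
    distrib₃ = solve-∀

∑-unordered-pairs : ∀ {n} (f g : Fin n → ℕ) →
  ∑² (λ x y → χ (x <ᶠ y) * (f x * g y + g x * f y)) + ∑[ x < n ] (f x * g x) ≡ sum f * sum g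
∑-unordered-pairs {n} f g = begin-equality
  ∑² (λ x y → χ (x <ᶠ y) * (f x * g y + g x * f y)) + ∑[ x < n ] (f x * g x)
    ≡⟨ cong (_+ ∑[ x < n ] (f x * g x)) (begin-equality
       ∑² (λ x y → χ (x <ᶠ y) * (f x * g y + g x * f y))
         ≡⟨ ∑²-cong (λ x y → *-distribˡ-+ (χ (x <ᶠ y)) (f x * g y) (g x * f y)) ⟩
       ∑² (λ x y → χ (x <ᶠ y) * (f x * g y) + χ (x <ᶠ y) * (g x * f y))
         ≡⟨ ∑²-distrib-+ (λ x y → χ (x <ᶠ y) * (f x * g y)) (λ x y → χ (x <ᶠ y) * (g x * f y)) ⟩
       ∑² (λ x y → χ (x <ᶠ y) * (f x * g y)) + ∑² (λ x y → χ (x <ᶠ y) * (g x * f y))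
         ≡⟨ cong (∑² (λ x y → χ (x <ᶠ y) * (f x * g y)) +_)
                 (trans (∑-comm (λ x y → χ (x <ᶠ y) * (g x * f y)))
                        (∑²-cong (λ x y → cong (χ (y <ᶠ x) *_) (*-comm (g y) (f x))))) ⟩
       ∑² (λ x y → χ (x <ᶠ y) * (f x * g y)) + ∑² (λ x y → χ (y <ᶠ x) * (f x * g y)) ∎) ⟩
  ∑² (λ x y → χ (x <ᶠ y) * (f x * g y)) + ∑² (λ x y → χ (y <ᶠ x) * (f x * g y))
    + ∑[ x < n ] (f x * g x)
    ≡⟨ ∑-ordered-pairs f g ⟩
  sum f * sum g ∎

card≡∑χ : ∀ {n} (p : Subset n) → ∣ p ∣ ≡ ∑[ x < n ] χ (lookup p x)
card≡∑χ []          = refl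
card≡∑χ (true  ∷ p) = cong suc (card≡∑χ p)
card≡∑χ (false ∷ p) = card≡∑χ p

lookup-∪ : ∀ {n} (p q : Subset n) x → lookup (p ∪ q) x ≡ lookup p x ∨ lookup q x
lookup-∪ p q x = lookup-zipWith _∨_ x p q

disjoint⇒lookup-∧ : ∀ {n} (p q : Subset n) → p ∩ q ≡ ⊥ → ∀ x → lookup p x ∧ lookup q x ≡ false
disjoint⇒lookup-∧ p q p∩q≡⊥ x =
  trans (sym (lookup-zipWith _∧_ x p q)) (trans (cong (λ r → lookup r x) p∩q≡⊥) (lookup-replicate x false))

∣p∪q∣≡∣p∣+∣q∣ : ∀ {n} (p q : Subset n) → p ∩ q ≡ ⊥ → ∣ p ∪ q ∣ ≡ ∣ p ∣ + ∣ q ∣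
∣p∪q∣≡∣p∣+∣q∣ {n} p q p∩q≡⊥ = begin-equality
  ∣ p ∪ q ∣                                              ≡⟨ card≡∑χ (p ∪ q) ⟩
  ∑[ x < n ] χ (lookup (p ∪ q) x)                        ≡⟨ sum-cong-≗ χ-∪ ⟩
  ∑[ x < n ] (χ (lookup p x) + χ (lookup q x))           ≡⟨ ∑-distrib-+ (χ ∘ lookup p) (χ ∘ lookup q) ⟩
  ∑[ x < n ] χ (lookup p x) + ∑[ x < n ] χ (lookup q x)  ≡⟨ cong₂ _+_ (card≡∑χ p) (card≡∑χ q) ⟨
  ∣ p ∣ + ∣ q ∣                                          ∎
  where
  χ-∨ : ∀ u v → u ∧ v ≡ false → χ (u ∨ v) ≡ χ u + χ v
  χ-∨ true  false _ = refl
  χ-∨ false v     _ = refl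
  χ-∪ : ∀ x → χ (lookup (p ∪ q) x) ≡ χ (lookup p x) + χ (lookup q x)
  χ-∪ x = trans (cong χ (lookup-∪ p q x)) (χ-∨ (lookup p x) (lookup q x) (disjoint⇒lookup-∧ p q p∩q≡⊥ x))

joinMult : ∀ {m} → Subset m → Subset m → Mult m → Mult m → Mult m
joinMult V₁ V₂ M₁ M₂ x y = M₁ x y + M₂ x y + cross V₁ V₂ x y

pairWeight : ∀ {m} → Subset m → Mult m → Fin m → Fin m → ℕ
pairWeight V M x y = χ (x <ᶠ y) * (χ (lookup V x ∧ lookup V y) * 2 ^ M x y)

weightOn : ∀ {m} → Subset m → Mult m → ℕ
weightOn V M = ∑² (pairWeight V M)

weight≡weightOn-⊤ : ∀ {m} (M : Mult m) → weight M ≡ weightOn ⊤ M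
weight≡weightOn-⊤ {m} M = begin-equality
  ListAction.sum (List.map row (allFin m))  ≡⟨ sum-allFin row ⟩
  ∑[ x < m ] row x                          ≡⟨ sum-cong-≗ (λ x → sum-allFin (entry x)) ⟩
  ∑[ x < m ] ∑[ y < m ] entry x y           ≡⟨ ∑²-cong entry≡pairWeight ⟩
  weightOn ⊤ M                              ∎
  where
  entry : Fin m → Fin m → ℕ
  entry x y = if x <ᶠ y then 2 ^ M x y else 0
  row : Fin m → ℕ
  row x = ListAction.sum (List.map (entry x) (allFin m))
  sum-allFin : (f : Fin m → ℕ) → ListAction.sum (List.map f (allFin m)) ≡ sum f
  sum-allFin = sum-tabulate id
    where
    sum-tabulate : ∀ {n} (g : Fin n → Fin m) (f : Fin m → ℕ) → ListAction.sum (List.map f (List.tabulate g)) ≡ sum (f ∘ g)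
    sum-tabulate {zero}  g f = refl
    sum-tabulate {suc n} g f = cong (f (g zero) +_) (sum-tabulate (g ∘ suc) f)
  entry≡pairWeight : ∀ x y → entry x y ≡ pairWeight ⊤ M x y
  entry≡pairWeight x y rewrite lookup-replicate x true | lookup-replicate y true with x <ᶠ y
  ... | true  = sym (trans (*-identityˡ _) (+-identityʳ _))
  ... | false = refl

∨-∧≡false : ∀ p q r s → (p ∨ q) ∧ (r ∨ s) ≡ false → (p ∧ r ≡ false) × (q ∧ s ≡ false)
∨-∧≡false true  _     true  _     ()
∨-∧≡false true  _     false true  ()
∨-∧≡false true  true  false false _ = refl , refl
∨-∧≡false true  false false false _ = refl , refl
∨-∧≡false false true  true  _     ()
∨-∧≡false false true  false true  ()
∨-∧≡false false true  false false _ = refl , refl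
∨-∧≡false false false _     true  _ = refl , refl
∨-∧≡false false false _     false _ = refl , refl

Rec2-outside : ∀ {m} {V : Subset m} {M : Mult m} → Rec2 V M →
  ∀ x y → lookup V x ∧ lookup V y ≡ false → M x y ≡ 0
Rec2-outside (base V _ _) x y _ = refl
Rec2-outside (split _ V₁ V₂ M₁ M₂ _ refl _ _ _ rec₁ rec₂) x y out
  rewrite lookup-∪ V₁ V₂ x | lookup-∪ V₁ V₂ y
  with ∨-∧≡false (lookup V₁ x) (lookup V₂ x) (lookup V₁ y) (lookup V₂ y) out
... | out₁ , out₂ rewrite Rec2-outside rec₁ x y out₁ | Rec2-outside rec₂ x y out₂ | out₁ | out₂ = refl

-- p, q say whether x lies in V₁, V₂ and r, s the same for y.
pairWeight-split-bits : (p q r s : Bool) (a b m₁ m₂ : ℕ) →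
  p ∧ q ≡ false → r ∧ s ≡ false → (p ∧ r ≡ false → m₁ ≡ 0) → (q ∧ s ≡ false → m₂ ≡ 0) →
  χ ((p ∨ q) ∧ (r ∨ s)) * 2 ^ (m₁ + m₂ + (if p ∧ r then b else if q ∧ s then a else 0))
    ≡ 2 ^ b * (χ (p ∧ r) * 2 ^ m₁) + 2 ^ a * (χ (q ∧ s) * 2 ^ m₂) + (χ p * χ s + χ q * χ r)
pairWeight-split-bits true  true  _     _     _ _ _  _  () _ _ _
pairWeight-split-bits _     _     true  true  _ _ _  _  _ () _ _
pairWeight-split-bits true  false true  false a b m₁ m₂ _ _ _ m₂≡0
  rewrite m₂≡0 refl | +-identityʳ m₁ | ^-distribˡ-+-* 2 m₁ b = inside (2 ^ m₁) (2 ^ b) (2 ^ a)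
  where
  inside : ∀ X Y A → 1 * (X * Y) ≡ Y * (1 * X) + A * 0 + 0
  inside = solve-∀
pairWeight-split-bits true  false false true  a b m₁ m₂ _ _ m₁≡0 m₂≡0
  rewrite m₁≡0 refl | m₂≡0 refl = sym (cong₂ (λ u v → u + v + 1) (*-zeroʳ (2 ^ b)) (*-zeroʳ (2 ^ a)))
pairWeight-split-bits true  false false false a b _  _  _ _ _ _ = sym (cong₂ (λ u v → u + v + 0) (*-zeroʳ (2 ^ b)) (*-zeroʳ (2 ^ a)))
pairWeight-split-bits false true  true  false a b m₁ m₂ _ _ m₁≡0 m₂≡0
  rewrite m₁≡0 refl | m₂≡0 refl = sym (cong₂ (λ u v → u + v + 1) (*-zeroʳ (2 ^ b)) (*-zeroʳ (2 ^ a)))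
pairWeight-split-bits false true  false true  a b m₁ m₂ _ _ m₁≡0 _
  rewrite m₁≡0 refl | ^-distribˡ-+-* 2 m₂ a = inside (2 ^ m₂) (2 ^ a) (2 ^ b)
  where
  inside : ∀ X Y B → 1 * (X * Y) ≡ B * 0 + Y * (1 * X) + 0
  inside = solve-∀
pairWeight-split-bits false true  false false a b _  _  _ _ _ _ = sym (cong₂ (λ u v → u + v + 0) (*-zeroʳ (2 ^ b)) (*-zeroʳ (2 ^ a)))
pairWeight-split-bits false false _     _     a b _  _  _ _ _ _ = sym (cong₂ (λ u v → u + v + 0) (*-zeroʳ (2 ^ b)) (*-zeroʳ (2 ^ a)))

pairWeight-split : ∀ {m} (V₁ V₂ : Subset m) (M₁ M₂ : Mult m) → Rec2 V₁ M₁ → Rec2 V₂ M₂ →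
  V₁ ∩ V₂ ≡ ⊥ → ∀ x y →
  pairWeight (V₁ ∪ V₂) (joinMult V₁ V₂ M₁ M₂) x y
    ≡ 2 ^ ∣ V₂ ∣ * pairWeight V₁ M₁ x y + 2 ^ ∣ V₁ ∣ * pairWeight V₂ M₂ x y
      + χ (x <ᶠ y) * (χ (lookup V₁ x) * χ (lookup V₂ y) + χ (lookup V₂ x) * χ (lookup V₁ y))
pairWeight-split V₁ V₂ M₁ M₂ rec₁ rec₂ disj x y
  rewrite lookup-∪ V₁ V₂ x | lookup-∪ V₁ V₂ y =
  trans (cong (χ (x <ᶠ y) *_)
          (pairWeight-split-bits (lookup V₁ x) (lookup V₂ x) (lookup V₁ y) (lookup V₂ y)
            ∣ V₁ ∣ ∣ V₂ ∣ (M₁ x y) (M₂ x y) (disjoint⇒lookup-∧ V₁ V₂ disj x)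
            (disjoint⇒lookup-∧ V₁ V₂ disj y) (Rec2-outside rec₁ x y) (Rec2-outside rec₂ x y)))
        (distrib (χ (x <ᶠ y)) (2 ^ ∣ V₁ ∣) (2 ^ ∣ V₂ ∣) _ _ _)
  where
  distrib : ∀ L A B X Y C → L * (B * X + A * Y + C) ≡ B * (L * X) + A * (L * Y) + L * C
  distrib = solve-∀

weightOn-split : ∀ {m} (V₁ V₂ : Subset m) (M₁ M₂ : Mult m) → Rec2 V₁ M₁ → Rec2 V₂ M₂ → V₁ ∩ V₂ ≡ ⊥ →
  weightOn (V₁ ∪ V₂) (joinMult V₁ V₂ M₁ M₂)
    ≡ 2 ^ ∣ V₂ ∣ * weightOn V₁ M₁ + 2 ^ ∣ V₁ ∣ * weightOn V₂ M₂ + ∣ V₁ ∣ * ∣ V₂ ∣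
weightOn-split {m} V₁ V₂ M₁ M₂ rec₁ rec₂ disj = begin-equality
  ∑² (pairWeight (V₁ ∪ V₂) (joinMult V₁ V₂ M₁ M₂))
    ≡⟨ ∑²-cong (pairWeight-split V₁ V₂ M₁ M₂ rec₁ rec₂ disj) ⟩
  ∑² (λ x y → B * pairWeight V₁ M₁ x y + A * pairWeight V₂ M₂ x y + crossing x y)
    ≡⟨ ∑²-distrib-+ (λ x y → B * pairWeight V₁ M₁ x y + A * pairWeight V₂ M₂ x y) crossing ⟩
  ∑² (λ x y → B * pairWeight V₁ M₁ x y + A * pairWeight V₂ M₂ x y) + ∑² crossing
    ≡⟨ cong (_+ ∑² crossing) (∑²-distrib-+ (λ x y → B * pairWeight V₁ M₁ x y) (λ x y → A * pairWeight V₂ M₂ x y)) ⟩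
  ∑² (λ x y → B * pairWeight V₁ M₁ x y) + ∑² (λ x y → A * pairWeight V₂ M₂ x y) + ∑² crossing
    ≡⟨ cong₂ (λ u v → u + v + ∑² crossing) (*-distribˡ-∑² B (pairWeight V₁ M₁))
                                            (*-distribˡ-∑² A (pairWeight V₂ M₂)) ⟨
  B * weightOn V₁ M₁ + A * weightOn V₂ M₂ + ∑² crossing
    ≡⟨ cong (B * weightOn V₁ M₁ + A * weightOn V₂ M₂ +_) ∑-crossing ⟩
  B * weightOn V₁ M₁ + A * weightOn V₂ M₂ + ∣ V₁ ∣ * ∣ V₂ ∣ ∎
  where
  A = 2 ^ ∣ V₁ ∣
  B = 2 ^ ∣ V₂ ∣
  in₁ in₂ : Fin m → ℕ
  in₁ x = χ (lookup V₁ x)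
  in₂ x = χ (lookup V₂ x)
  crossing : Fin m → Fin m → ℕ
  crossing x y = χ (x <ᶠ y) * (in₁ x * in₂ y + in₂ x * in₁ y)
  χ-disjoint : ∀ u v → u ∧ v ≡ false → χ u * χ v ≡ 0
  χ-disjoint true  false _ = refl
  χ-disjoint false _     _ = refl
  diagonal-vanishes : ∑[ x < m ] (in₁ x * in₂ x) ≡ 0
  diagonal-vanishes = trans (sum-cong-≗ λ x → χ-disjoint (lookup V₁ x) (lookup V₂ x) (disjoint⇒lookup-∧ V₁ V₂ disj x))
                            (sum-replicate-zero m)
  ∑-crossing : ∑² crossing ≡ ∣ V₁ ∣ * ∣ V₂ ∣
  ∑-crossing = begin-equality
    ∑² crossing                               ≡⟨ +-identityʳ _ ⟨
    ∑² crossing + 0                           ≡⟨ cong (∑² crossing +_) diagonal-vanishes ⟨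
    ∑² crossing + ∑[ x < m ] (in₁ x * in₂ x)  ≡⟨ ∑-unordered-pairs in₁ in₂ ⟩
    sum in₁ * sum in₂                         ≡⟨ cong₂ _*_ (card≡∑χ V₁) (card≡∑χ V₂) ⟨
    ∣ V₁ ∣ * ∣ V₂ ∣                           ∎

weightOn-edgeless : ∀ {m} (V : Subset m) → 2 * weightOn V (λ _ _ → 0) + ∣ V ∣ ≡ ∣ V ∣ * ∣ V ∣
weightOn-edgeless {m} V = begin-equality
  2 * weightOn V (λ _ _ → 0) + ∣ V ∣
    ≡⟨ cong₂ _+_ (*-distribˡ-∑² 2 (pairWeight V (λ _ _ → 0))) (card≡∑χ V) ⟩
  ∑² (λ x y → 2 * pairWeight V (λ _ _ → 0) x y) + sum f
    ≡⟨ cong₂ _+_ (∑²-cong pair) (sum-cong-≗ (λ x → sym (χ-idem (lookup V x)))) ⟩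
  ∑² (λ x y → χ (x <ᶠ y) * (f x * f y + f x * f y)) + ∑[ x < m ] (f x * f x)
    ≡⟨ ∑-unordered-pairs f f ⟩
  sum f * sum f
    ≡⟨ cong₂ _*_ (card≡∑χ V) (card≡∑χ V) ⟨
  ∣ V ∣ * ∣ V ∣ ∎
  where
  f : Fin m → ℕ
  f x = χ (lookup V x)
  χ-idem : ∀ u → χ u * χ u ≡ χ u
  χ-idem true  = refl
  χ-idem false = refl
  χ-∧ : ∀ u v → χ (u ∧ v) ≡ χ u * χ v
  χ-∧ true  true  = refl
  χ-∧ true  false = refl
  χ-∧ false _     = refl
  pair : ∀ x y → 2 * pairWeight V (λ _ _ → 0) x y ≡ χ (x <ᶠ y) * (f x * f y + f x * f y)
  pair x y rewrite χ-∧ (lookup V x) (lookup V y) = rearrange (χ (x <ᶠ y)) (f x * f y)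
    where
    rearrange : ∀ l p → 2 * (l * (p * 1)) ≡ l * (p + p)
    rearrange = solve-∀

-- g k = gNum k / gDen k.
gDen : ℕ → ℕ
gDen k = 2 ^ 2 ^ k

gNum : ℕ → ℕ
gNum zero    = 0
gNum (suc k) = gNum k * gDen k + 2 ^ k

-- gBound n = 2 · n 2^(n-1) · g ⌊log₂ n⌋, the bound on 2 H₂(n) claimed by the theorem.
gBound : ℕ → ℕ
gBound n = n * 2 ^ (n ∸ 2 ^ ⌊log₂ n ⌋) * gNum ⌊log₂ n ⌋

-- The exceptional values are 2 H₂(3), 2 H₂(6), 2 H₂(7), which exceed gBound.
wBound : ℕ → ℕ
wBound 3 = 8
wBound 6 = 146
wBound 7 = 344
wBound n = gBound n

-- By weightOn-split, this bounds 2·weight of a split into parts of sizes a, b meeting wBound.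
splitBound : ℕ → ℕ → ℕ
splitBound a b = 2 ^ b * wBound a + 2 ^ a * wBound b + 2 * (a * b)

NotPowerOf2 : ℕ → Set
NotPowerOf2 n = ∀ k → n ≢ 2 ^ k

wBound≡gBound : ∀ n → n ≢ 3 → n ≢ 6 → n ≢ 7 → wBound n ≡ gBound n
wBound≡gBound 3 n≢3 _ _ = contradiction refl n≢3
wBound≡gBound 6 _ n≢6 _ = contradiction refl n≢6
wBound≡gBound 7 _ _ n≢7 = contradiction refl n≢7
wBound≡gBound 0 _ _ _ = refl
wBound≡gBound 1 _ _ _ = refl
wBound≡gBound 2 _ _ _ = refl
wBound≡gBound 4 _ _ _ = refl
wBound≡gBound 5 _ _ _ = refl
wBound≡gBound (suc (suc (suc (suc (suc (suc (suc (suc n)))))))) _ _ _ = refl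

wBound≡gBound-≥8 : ∀ {n} → 8 ≤ n → wBound n ≡ gBound n
wBound≡gBound-≥8 (s≤s (s≤s (s≤s (s≤s (s≤s (s≤s (s≤s (s≤s _)))))))) = refl

n<2^n : ∀ n → n < 2 ^ n
n<2^n zero    = s≤s z≤n
n<2^n (suc n) = begin-strict
  suc n          ≤⟨ n<2^n n ⟩
  2 ^ n          <⟨ m<m+n (2 ^ n) (m^n>0 2 n) ⟩
  2 ^ n + 2 ^ n  ≡⟨ cong (2 ^ n +_) (+-identityʳ (2 ^ n)) ⟨
  2 ^ suc n      ∎

2^⌊log₂n⌋≤n : ∀ {n} → 1 ≤ n → 2 ^ ⌊log₂ n ⌋ ≤ n
2^⌊log₂n⌋≤n 1≤n = by-level _ _ refl 1≤n
  where
  by-level : ∀ k n → ⌊log₂ n ⌋ ≡ k → 1 ≤ n → 2 ^ k ≤ n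
  by-level zero    n               _    1≤n = 1≤n
  by-level (suc k) 1               ()
  by-level (suc k) n@(suc (suc _)) log≡ _   = begin
    2 * 2 ^ k              ≤⟨ *-monoʳ-≤ 2 (by-level k ⌊ n /2⌋ log-half (s≤s z≤n)) ⟩
    2 * ⌊ n /2⌋            ≡⟨ cong (⌊ n /2⌋ +_) (+-identityʳ ⌊ n /2⌋) ⟩
    ⌊ n /2⌋ + ⌊ n /2⌋      ≤⟨ +-monoʳ-≤ ⌊ n /2⌋ (⌊n/2⌋≤⌈n/2⌉ n) ⟩
    ⌊ n /2⌋ + ⌈ n /2⌉      ≡⟨ ⌊n/2⌋+⌈n/2⌉≡n n ⟩
    n                      ∎
    where
    log-half : ⌊log₂ ⌊ n /2⌋ ⌋ ≡ k
    log-half = trans (⌊log₂⌊n/2⌋⌋≡⌊log₂n⌋∸1 n) (cong (_∸ 1) log≡)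

n<2^suc⌊log₂n⌋ : ∀ n → n < 2 ^ suc ⌊log₂ n ⌋
n<2^suc⌊log₂n⌋ n = ≰⇒> λ 2^k+1≤n → 1+n≰n (begin
  suc ⌊log₂ n ⌋               ≡⟨ ⌊log₂[2^n]⌋≡n (suc ⌊log₂ n ⌋) ⟨
  ⌊log₂ (2 ^ suc ⌊log₂ n ⌋) ⌋ ≤⟨ ⌊log₂⌋-mono-≤ 2^k+1≤n ⟩
  ⌊log₂ n ⌋                   ∎)

⌊log₂⌋<-2^ : ∀ {n c} → 1 ≤ n → n < 2 ^ c → ⌊log₂ n ⌋ < c
⌊log₂⌋<-2^ 1≤n n<2^c = ≰⇒> λ c≤⌊log₂n⌋ → <⇒≱ n<2^c (≤-trans (^-monoʳ-≤ 2 c≤⌊log₂n⌋) (2^⌊log₂n⌋≤n 1≤n))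

gDen≢0 : ∀ k → NonZero (gDen k)
gDen≢0 k = m^n≢0 2 (2 ^ k)

gDen-suc : ∀ k → gDen (suc k) ≡ gDen k * gDen k
gDen-suc k = trans (cong (λ e → 2 ^ (2 ^ k + e)) (+-identityʳ (2 ^ k))) (^-distribˡ-+-* 2 (2 ^ k) (2 ^ k))

gNum-ratio-mono : ∀ {j k} → j ≤ k → gNum j * gDen k ≤ gNum k * gDen j
gNum-ratio-step : ∀ {c k} → c ≤ k → gNum c * gDen (suc k) + 2 ^ k * gDen c ≤ gNum (suc k) * gDen c

gNum-ratio-mono {k = zero}  z≤n = ≤-refl
gNum-ratio-mono {j} {suc k} j≤1+k with m≤n⇒m<n∨m≡n j≤1+k
... | inj₂ refl        = ≤-refl
... | inj₁ (s≤s j≤k) = ≤-trans (m≤m+n _ _) (gNum-ratio-step j≤k)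

gNum-ratio-step {c} {k} c≤k = begin
  gNum c * gDen (suc k) + 2 ^ k * gDen c       ≡⟨ cong (λ d → gNum c * d + 2 ^ k * gDen c) (gDen-suc k) ⟩
  gNum c * (gDen k * gDen k) + 2 ^ k * gDen c  ≡⟨ cong (_+ 2 ^ k * gDen c) (*-assoc (gNum c) (gDen k) (gDen k)) ⟨
  gNum c * gDen k * gDen k + 2 ^ k * gDen c    ≤⟨ +-monoˡ-≤ _ (*-monoˡ-≤ (gDen k) (gNum-ratio-mono c≤k)) ⟩
  gNum k * gDen c * gDen k + 2 ^ k * gDen c    ≡⟨ regroup (gNum k) (gDen c) (gDen k) (2 ^ k) ⟩
  gNum (suc k) * gDen c                        ∎
  where
  regroup : ∀ a b c d → a * b * c + d * b ≡ (a * c + d) * b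
  regroup = solve-∀

gBound-scaled : ∀ {n} → 1 ≤ n → gBound n * gDen ⌊log₂ n ⌋ ≡ n * 2 ^ n * gNum ⌊log₂ n ⌋
gBound-scaled {n} 1≤n = begin-equality
  n * 2 ^ (n ∸ p) * G * 2 ^ p    ≡⟨ regroup n (2 ^ (n ∸ p)) G (2 ^ p) ⟩
  n * (2 ^ (n ∸ p) * 2 ^ p) * G  ≡⟨ cong (λ e → n * e * G) (^-distribˡ-+-* 2 (n ∸ p) p) ⟨
  n * 2 ^ (n ∸ p + p) * G        ≡⟨ cong (λ e → n * 2 ^ e * G) (m∸n+n≡m (2^⌊log₂n⌋≤n 1≤n)) ⟩
  n * 2 ^ n * G                  ∎
  where
  p = 2 ^ ⌊log₂ n ⌋
  G = gNum ⌊log₂ n ⌋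
  regroup : ∀ a b c d → a * b * c * d ≡ a * (b * d) * c
  regroup = solve-∀

SplitOK SplitOK< : ℕ → ℕ → Set
SplitOK  a b = splitBound a b ≤ wBound (a + b)
SplitOK< a b = splitBound a b < wBound (a + b)

-- Row j, column i of a table lists the split a = 1 + i, b = c + j ∸ i of a + b = c + 1 + j.
fromTable : ∀ (P : ℕ → ℕ → Set) c n →
  (∀ (j : Fin n) (i : Fin (c + toℕ j)) → P (suc (toℕ i)) (c + toℕ j ∸ toℕ i)) →
  ∀ a b → 1 ≤ a → 1 ≤ b → suc c ≤ a + b → a + b < suc c + n → P a b
fromTable P c n table (suc a) b _ 1≤b c<a+b a+b<1+c+n = subst₂ P
  (cong suc (toℕ-fromℕ< a<c+j))
  (trans (cong (λ t → c + t ∸ toℕ i) (toℕ-fromℕ< j<n)) (trans (cong (c + (a + b ∸ c) ∸_) (toℕ-fromℕ< a<c+j)) b≡))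
  (table j i)
  where
  c≤a+b : c ≤ a + b
  c≤a+b = ≤-pred c<a+b
  j<n : a + b ∸ c < n
  j<n = +-cancelˡ-< c (a + b ∸ c) n (subst (_< c + n) (sym (m+[n∸m]≡n c≤a+b)) (≤-pred a+b<1+c+n))
  j = fromℕ< j<n
  a<c+j : a < c + toℕ j
  a<c+j = subst (a <_) (trans (sym (m+[n∸m]≡n c≤a+b)) (cong (c +_) (sym (toℕ-fromℕ< j<n)))) (m<m+n a 1≤b)
  i = fromℕ< a<c+j
  b≡ : c + (a + b ∸ c) ∸ a ≡ b
  b≡ = trans (cong (_∸ a) (m+[n∸m]≡n c≤a+b)) (m+n∸m≡n a b)

splitOK-small : ∀ a b → 1 ≤ a → 1 ≤ b → 3 ≤ a + b → a + b ≤ 15 → SplitOK a b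
splitOK-small a b 1≤a 1≤b 3≤a+b a+b≤15 = fromTable SplitOK 2 13
  (from-yes (all? {n = 13} λ j → all? {n = 2 + toℕ j} λ i →
     splitBound (suc (toℕ i)) (2 + toℕ j ∸ toℕ i) ≤? wBound (suc (toℕ i) + (2 + toℕ j ∸ toℕ i))))
  a b 1≤a 1≤b 3≤a+b (s≤s a+b≤15)

splitOK<-small : ∀ a b → 1 ≤ a → 1 ≤ b → 9 ≤ a + b → a + b ≤ 15 → SplitOK< a b
splitOK<-small a b 1≤a 1≤b 9≤a+b a+b≤15 = fromTable SplitOK< 8 7
  (from-yes (all? {n = 7} λ j → all? {n = 8 + toℕ j} λ i →
     splitBound (suc (toℕ i)) (8 + toℕ j ∸ toℕ i) <? wBound (suc (toℕ i) + (8 + toℕ j ∸ toℕ i))))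
  a b 1≤a 1≤b 9≤a+b (s≤s a+b≤15)

gBound-term-scaled : ∀ {x} y E → 1 ≤ x →
  2 ^ y * gBound x * E * gDen ⌊log₂ x ⌋ ≡ x * 2 ^ (x + y) * (gNum ⌊log₂ x ⌋ * E)
gBound-term-scaled {x} y E 1≤x = begin-equality
  2 ^ y * gBound x * E * D                    ≡⟨ regroup (2 ^ y) (gBound x) E D ⟩
  2 ^ y * (gBound x * D) * E                  ≡⟨ cong (λ t → 2 ^ y * t * E) (gBound-scaled 1≤x) ⟩
  2 ^ y * (x * 2 ^ x * gNum ⌊log₂ x ⌋) * E    ≡⟨ regroup′ (2 ^ y) x (2 ^ x) (gNum ⌊log₂ x ⌋) E ⟩
  x * (2 ^ x * 2 ^ y) * (gNum ⌊log₂ x ⌋ * E)  ≡⟨ cong (λ t → x * t * (gNum ⌊log₂ x ⌋ * E)) (^-distribˡ-+-* 2 x y) ⟨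
  x * 2 ^ (x + y) * (gNum ⌊log₂ x ⌋ * E)      ∎
  where
  D = gDen ⌊log₂ x ⌋
  regroup : ∀ p g e d → p * g * e * d ≡ p * (g * d) * e
  regroup = solve-∀
  regroup′ : ∀ p x q n e → p * (x * q * n) * e ≡ x * (q * p) * (n * e)
  regroup′ = solve-∀

scaled-term : ∀ {x k} y → 1 ≤ x → ⌊log₂ x ⌋ ≤ k →
  2 ^ y * gBound x * gDen k ≤ x * (2 ^ (x + y) * gNum k)
scaled-term {x} {k} y 1≤x ⌊log₂x⌋≤k = *-cancelʳ-≤ _ _ (gDen j) {{gDen≢0 j}} (begin
  2 ^ y * gBound x * gDen k * gDen j      ≡⟨ gBound-term-scaled y (gDen k) 1≤x ⟩
  x * 2 ^ (x + y) * (gNum j * gDen k)     ≤⟨ *-monoʳ-≤ (x * 2 ^ (x + y)) (gNum-ratio-mono ⌊log₂x⌋≤k) ⟩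
  x * 2 ^ (x + y) * (gNum k * gDen j)     ≡⟨ regroup x (2 ^ (x + y)) (gNum k) (gDen j) ⟩
  x * (2 ^ (x + y) * gNum k) * gDen j     ∎)
  where
  j = ⌊log₂ x ⌋
  regroup : ∀ x p n d → x * p * (n * d) ≡ x * (p * n) * d
  regroup = solve-∀

scaled-term-slack : ∀ {x k} y → 1 ≤ x → ⌊log₂ x ⌋ ≤ k →
  2 ^ y * gBound x * gDen (suc k) + x * (2 ^ (x + y) * 2 ^ k) ≤ x * (2 ^ (x + y) * gNum (suc k))
scaled-term-slack {x} {k} y 1≤x ⌊log₂x⌋≤k = *-cancelʳ-≤ _ _ (gDen j) {{gDen≢0 j}} (begin
  (2 ^ y * gBound x * gDen (suc k) + x * (2 ^ (x + y) * 2 ^ k)) * gDen j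
    ≡⟨ *-distribʳ-+ (gDen j) (2 ^ y * gBound x * gDen (suc k)) _ ⟩
  2 ^ y * gBound x * gDen (suc k) * gDen j + x * (2 ^ (x + y) * 2 ^ k) * gDen j
    ≡⟨ cong₂ _+_ (gBound-term-scaled y (gDen (suc k)) 1≤x) (sym (regroup x (2 ^ (x + y)) (2 ^ k) (gDen j))) ⟩
  x * 2 ^ (x + y) * (gNum j * gDen (suc k)) + x * 2 ^ (x + y) * (2 ^ k * gDen j)
    ≡⟨ *-distribˡ-+ (x * 2 ^ (x + y)) (gNum j * gDen (suc k)) _ ⟨
  x * 2 ^ (x + y) * (gNum j * gDen (suc k) + 2 ^ k * gDen j)
    ≤⟨ *-monoʳ-≤ (x * 2 ^ (x + y)) (gNum-ratio-step ⌊log₂x⌋≤k) ⟩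
  x * 2 ^ (x + y) * (gNum (suc k) * gDen j)
    ≡⟨ regroup x (2 ^ (x + y)) (gNum (suc k)) (gDen j) ⟩
  x * (2 ^ (x + y) * gNum (suc k)) * gDen j ∎)
  where
  j = ⌊log₂ x ⌋
  regroup : ∀ x p n d → x * p * (n * d) ≡ x * (p * n) * d
  regroup = solve-∀

8*n<2^n : ∀ n → 9 ≤ n → 8 * n < 2 ^ n
8*n<2^n n 9≤n with m≤n⇒∃[o]m+o≡n 9≤n
... | d , refl = from9 d
  where
  from9 : ∀ d → 8 * (9 + d) < 2 ^ (9 + d)
  from9 zero    = from-yes (8 * 9 <? 2 ^ 9)
  from9 (suc d) = begin-strict
    8 * (9 + suc d)           ≡⟨ trans (*-suc 8 (9 + d)) (+-comm 8 _) ⟩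
    8 * (9 + d) + 8           <⟨ +-monoˡ-< 8 (from9 d) ⟩
    2 ^ (9 + d) + 8           ≤⟨ +-monoʳ-≤ (2 ^ (9 + d)) (≤-trans (from-yes (8 ≤? 2 ^ 9)) (^-monoʳ-≤ 2 (m≤m+n 9 d))) ⟩
    2 ^ (9 + d) + 2 ^ (9 + d) ≡⟨ cong (2 ^ (9 + d) +_) (+-identityʳ _) ⟨
    2 ^ suc (9 + d)           ∎

dominate-linear : ∀ {a} P Q T → 9 ≤ a → Q ≤ 8 * T → 1 ≤ T → P * 2 ^ a + Q * a < (P + T) * 2 ^ a
dominate-linear {a} P Q T 9≤a Q≤8T 1≤T = begin-strict
  P * 2 ^ a + Q * a        ≤⟨ +-monoʳ-≤ (P * 2 ^ a) (*-monoˡ-≤ a Q≤8T) ⟩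
  P * 2 ^ a + 8 * T * a    ≡⟨ cong (P * 2 ^ a +_) (regroup T a) ⟩
  P * 2 ^ a + T * (8 * a)  <⟨ +-monoʳ-< (P * 2 ^ a) (*-monoʳ-< T {{>-nonZero 1≤T}} (8*n<2^n a 9≤a)) ⟩
  P * 2 ^ a + T * 2 ^ a    ≡⟨ *-distribʳ-+ (2 ^ a) P T ⟨
  (P + T) * 2 ^ a          ∎
  where
  regroup : ∀ T a → 8 * T * a ≡ T * (8 * a)
  regroup = solve-∀

-- The sides b for which the generic estimate fails (b < 3 or wBound b ≠ gBound b); for them
-- the split is compared with g at the fixed level j instead, which works once a ≥ 9.
data SmallSide : ℕ → ℕ → Set where
  side₁ : SmallSide 1 1
  side₂ : SmallSide 2 2
  side₃ : SmallSide 3 2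
  side₆ : SmallSide 6 3
  side₇ : SmallSide 7 3

SmallSide-≤ : ∀ {b j} → SmallSide b j → b ≤ 7 × j ≤ 3
SmallSide-≤ side₁ = from-yes (1 ≤? 7) , from-yes (1 ≤? 3)
SmallSide-≤ side₂ = from-yes (2 ≤? 7) , from-yes (2 ≤? 3)
SmallSide-≤ side₃ = from-yes (3 ≤? 7) , from-yes (2 ≤? 3)
SmallSide-≤ side₆ = from-yes (6 ≤? 7) , ≤-refl
SmallSide-≤ side₇ = ≤-refl , ≤-refl

smallSide-from-constants : ∀ {a b j} P Q T → 9 ≤ a → Q ≤ 8 * T → 1 ≤ T →
  wBound b * gDen j ≡ P → 2 * b * gDen j ≡ Q → b * 2 ^ b * gNum j ≡ P + T →
  (2 ^ a * wBound b + 2 * (a * b)) * gDen j < b * 2 ^ (a + b) * gNum j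
smallSide-from-constants {a} {b} {j} P Q T 9≤a Q≤8T 1≤T ≡P ≡Q ≡P+T = begin-strict
  (2 ^ a * wBound b + 2 * (a * b)) * gDen j       ≡⟨ regroup (2 ^ a) (wBound b) a b (gDen j) ⟩
  wBound b * gDen j * 2 ^ a + 2 * b * gDen j * a  ≡⟨ cong₂ (λ p q → p * 2 ^ a + q * a) ≡P ≡Q ⟩
  P * 2 ^ a + Q * a                               <⟨ dominate-linear P Q T 9≤a Q≤8T 1≤T ⟩
  (P + T) * 2 ^ a                                 ≡⟨ cong (_* 2 ^ a) ≡P+T ⟨
  b * 2 ^ b * gNum j * 2 ^ a                      ≡⟨ regroup′ b (2 ^ b) (gNum j) (2 ^ a) ⟩
  b * (2 ^ a * 2 ^ b) * gNum j                    ≡⟨ cong (λ p → b * p * gNum j) (^-distribˡ-+-* 2 a b) ⟨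
  b * 2 ^ (a + b) * gNum j                        ∎
  where
  regroup : ∀ p w a b d → (p * w + 2 * (a * b)) * d ≡ w * d * p + 2 * b * d * a
  regroup = solve-∀
  regroup′ : ∀ b q n p → b * q * n * p ≡ b * (p * q) * n
  regroup′ = solve-∀

smallSide-at-level : ∀ {a b j} → SmallSide b j → 9 ≤ a →
  (2 ^ a * wBound b + 2 * (a * b)) * gDen j < b * 2 ^ (a + b) * gNum j
smallSide-at-level side₁ 9≤a = smallSide-from-constants {j = 1} 0     8    2    9≤a (from-yes (8 ≤? 16))      (s≤s z≤n) refl refl refl
smallSide-at-level side₂ 9≤a = smallSide-from-constants {j = 2} 32    64   16   9≤a (from-yes (64 ≤? 128))    (s≤s z≤n) refl refl refl
smallSide-at-level side₃ 9≤a = smallSide-from-constants {j = 2} 128   96   16   9≤a (from-yes (96 ≤? 128))    (s≤s z≤n) refl refl refl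
smallSide-at-level side₆ 9≤a = smallSide-from-constants {j = 3} 37376 3072 1024 9≤a (from-yes (3072 ≤? 8192))  (s≤s z≤n) refl refl refl
smallSide-at-level side₇ 9≤a = smallSide-from-constants {j = 3} 88064 3584 1536 9≤a (from-yes (3584 ≤? 12288)) (s≤s z≤n) refl refl refl

smallSide-term : ∀ {a b j k} → SmallSide b j → 9 ≤ a → j ≤ k →
  2 ^ a * wBound b * gDen k + 2 * (a * b) * gDen k < b * (2 ^ (a + b) * gNum k)
smallSide-term {a} {b} {j} {k} side 9≤a j≤k = *-cancelʳ-< (gDen j) _ _ (begin-strict
  (2 ^ a * wBound b * gDen k + 2 * (a * b) * gDen k) * gDen j
    ≡⟨ regroup (2 ^ a * wBound b) (2 * (a * b)) (gDen k) (gDen j) ⟩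
  (2 ^ a * wBound b + 2 * (a * b)) * gDen j * gDen k
    <⟨ *-monoˡ-< (gDen k) {{gDen≢0 k}} (smallSide-at-level side 9≤a) ⟩
  b * 2 ^ (a + b) * gNum j * gDen k
    ≡⟨ *-assoc (b * 2 ^ (a + b)) (gNum j) (gDen k) ⟩
  b * 2 ^ (a + b) * (gNum j * gDen k)
    ≤⟨ *-monoʳ-≤ (b * 2 ^ (a + b)) (gNum-ratio-mono j≤k) ⟩
  b * 2 ^ (a + b) * (gNum k * gDen j)
    ≡⟨ regroup′ b (2 ^ (a + b)) (gNum k) (gDen j) ⟩
  b * (2 ^ (a + b) * gNum k) * gDen j ∎)
  where
  regroup : ∀ x y d e → (x * d + y * d) * e ≡ (x + y) * e * d
  regroup = solve-∀
  regroup′ : ∀ x p n d → x * p * (n * d) ≡ x * (p * n) * d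
  regroup′ = solve-∀

linear<exponential : ∀ P d B E → 1 ≤ P → 8 ≤ B → suc d ≤ E → 2 * (2 * P + d) < E * B * P
linear<exponential P d B E 1≤P 8≤B 1+d≤E = begin-strict
  2 * (2 * P + d)          ≡⟨ expand P d ⟩
  4 * P + 2 * d            <⟨ +-mono-<-≤ (*-monoˡ-< P {{>-nonZero 1≤P}} (from-yes (4 <? 8)))
                                         (*-monoʳ-≤ 2 (m≤m*n d P {{>-nonZero 1≤P}})) ⟩
  8 * P + 2 * (d * P)      ≤⟨ +-monoʳ-≤ (8 * P) (*-monoˡ-≤ (d * P) (from-yes (2 ≤? 8))) ⟩
  8 * P + 8 * (d * P)      ≡⟨ collect P d ⟩
  suc d * 8 * P            ≤⟨ *-monoˡ-≤ P (*-mono-≤ 1+d≤E 8≤B) ⟩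
  E * B * P                ∎
  where
  expand : ∀ P d → 2 * (2 * P + d) ≡ 4 * P + 2 * d
  expand = solve-∀
  collect : ∀ P d → 8 * P + 8 * (d * P) ≡ suc d * 8 * P
  collect = solve-∀

cross-term-top : ∀ {a b k d} → a ≡ 2 ^ suc k + d → 3 ≤ b →
  2 * (a * b) * gDen (suc k) < b * (2 ^ (a + b) * 2 ^ k)
cross-term-top {a} {b} {k} {d} refl 3≤b = begin-strict
  2 * (a * b) * D                  ≡⟨ regroup a b D ⟩
  2 * a * (b * D)                  <⟨ *-monoˡ-< (b * D) {{m*n≢0 b D {{>-nonZero (≤-trans (s≤s z≤n) 3≤b)}} {{gDen≢0 (suc k)}}}}
                                        (linear<exponential (2 ^ k) d (2 ^ b) (2 ^ d) (m^n>0 2 k) (^-monoʳ-≤ 2 3≤b) (n<2^n d)) ⟩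
  2 ^ d * 2 ^ b * 2 ^ k * (b * D)  ≡⟨ regroup′ (2 ^ d) (2 ^ b) (2 ^ k) b D ⟩
  b * (D * 2 ^ d * 2 ^ b * 2 ^ k)  ≡⟨ cong (λ p → b * (p * 2 ^ b * 2 ^ k)) (^-distribˡ-+-* 2 (2 ^ suc k) d) ⟨
  b * (2 ^ a * 2 ^ b * 2 ^ k)      ≡⟨ cong (λ p → b * (p * 2 ^ k)) (^-distribˡ-+-* 2 a b) ⟨
  b * (2 ^ (a + b) * 2 ^ k)        ∎
  where
  D = gDen (suc k)
  regroup : ∀ a b D → 2 * (a * b) * D ≡ 2 * a * (b * D)
  regroup = solve-∀
  regroup′ : ∀ e p q b D → e * p * q * (b * D) ≡ b * (D * e * p * q)
  regroup′ = solve-∀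

x+2^r*x≤2^[1+r]*x : ∀ x r → x + 2 ^ r * x ≤ 2 ^ suc r * x
x+2^r*x≤2^[1+r]*x x r = begin
  x + 2 ^ r * x          ≤⟨ +-monoˡ-≤ (2 ^ r * x) (m≤n*m x (2 ^ r) {{m^n≢0 2 r}}) ⟩
  2 ^ r * x + 2 ^ r * x  ≡⟨ double (2 ^ r) x ⟩
  2 ^ suc r * x          ∎
  where
  double : ∀ p x → p * x + p * x ≡ 2 * p * x
  double = solve-∀

x+r≤2^r*x : ∀ x r → 1 ≤ x → x + r ≤ 2 ^ r * x
x+r≤2^r*x x zero    _   = ≤-reflexive (trans (+-identityʳ x) (sym (*-identityˡ x)))
x+r≤2^r*x x (suc r) 1≤x = begin
  x + suc r      ≡⟨ +-suc x r ⟩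
  suc (x + r)    ≤⟨ +-mono-≤ 1≤x (x+r≤2^r*x x r 1≤x) ⟩
  x + 2 ^ r * x  ≤⟨ x+2^r*x≤2^[1+r]*x x r ⟩
  2 ^ suc r * x  ∎

x+r<2^r*x : ∀ x r → 2 ≤ x → 1 ≤ r → x + r < 2 ^ r * x
x+r<2^r*x x (suc r) 2≤x _ = begin-strict
  x + suc r      ≡⟨ +-suc x r ⟩
  suc (x + r)    <⟨ +-mono-<-≤ 2≤x (x+r≤2^r*x x r (≤-trans (s≤s z≤n) 2≤x)) ⟩
  x + 2 ^ r * x  ≤⟨ x+2^r*x≤2^[1+r]*x x r ⟩
  2 ^ suc r * x  ∎

2^r*2^k*gDen : ∀ {m k r} → m ≡ 2 ^ k + r → 2 ^ r * 2 ^ k * gDen k ≡ 2 ^ m * 2 ^ k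
2^r*2^k*gDen {m} {k} {r} refl = begin-equality
  2 ^ r * 2 ^ k * gDen k   ≡⟨ regroup (2 ^ r) (2 ^ k) (gDen k) ⟩
  gDen k * 2 ^ r * 2 ^ k   ≡⟨ cong (_* 2 ^ k) (^-distribˡ-+-* 2 (2 ^ k) r) ⟨
  2 ^ (2 ^ k + r) * 2 ^ k  ∎
  where
  regroup : ∀ p q d → p * q * d ≡ d * p * q
  regroup = solve-∀

m*gDen≤ : ∀ {m k r} → m ≡ 2 ^ k + r → m * gDen k ≤ 2 ^ m * 2 ^ k
m*gDen≤ {m} {k} {r} m≡ = begin
  m * gDen k               ≡⟨ cong (_* gDen k) m≡ ⟩
  (2 ^ k + r) * gDen k     ≤⟨ *-monoˡ-≤ (gDen k) (x+r≤2^r*x (2 ^ k) r (m^n>0 2 k)) ⟩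
  2 ^ r * 2 ^ k * gDen k   ≡⟨ 2^r*2^k*gDen {k = k} {r} m≡ ⟩
  2 ^ m * 2 ^ k            ∎

m*gDen< : ∀ {m k r} → m ≡ 2 ^ suc k + r → 1 ≤ r → m * gDen (suc k) < 2 ^ m * 2 ^ suc k
m*gDen< {m} {k} {r} m≡ 1≤r = begin-strict
  m * gDen (suc k)                   ≡⟨ cong (_* gDen (suc k)) m≡ ⟩
  (2 ^ suc k + r) * gDen (suc k)     <⟨ *-monoˡ-< (gDen (suc k)) {{gDen≢0 (suc k)}}
                                          (x+r<2^r*x (2 ^ suc k) r (^-monoʳ-≤ 2 (s≤s (z≤n {k}))) 1≤r) ⟩
  2 ^ r * 2 ^ suc k * gDen (suc k)   ≡⟨ 2^r*2^k*gDen {k = suc k} {r} m≡ ⟩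
  2 ^ m * 2 ^ suc k                  ∎

4*m*n≤[m+n]² : ∀ m n → 4 * (m * n) ≤ (m + n) * (m + n)
4*m*n≤[m+n]² m n = [ bound , (λ m≤n → subst₂ _≤_ (cong (4 *_) (*-comm n m)) (cong₂ _*_ m+n≡ m+n≡) (bound m≤n)) ]′
  (≤-total n m)
  where
  m+n≡ = +-comm n m
  bound : ∀ {x y} → y ≤ x → 4 * (x * y) ≤ (x + y) * (x + y)
  bound {y = y} y≤x with m≤n⇒∃[o]m+o≡n y≤x
  ... | e , refl = subst (4 * ((y + e) * y) ≤_) (sym (square y e)) (m≤m+n _ _)
    where
    square : ∀ y e → (y + e + y) * (y + e + y) ≡ 4 * ((y + e) * y) + e * e
    square = solve-∀

cross-term-low : ∀ {a b k r} → a + b ≡ 2 ^ suc k + r →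
  (2 * (a * b) * gDen (suc k) ≤ (a + b) * (2 ^ (a + b) * 2 ^ k))
  × (1 ≤ r → 2 * (a * b) * gDen (suc k) < (a + b) * (2 ^ (a + b) * 2 ^ k))
cross-term-low {a} {b} {k} {r} m≡ =
  *-cancelʳ-≤ _ _ 2 (≤-trans doubled (≤-trans (*-monoʳ-≤ m (m*gDen≤ {k = suc k} {r} m≡)) (≤-reflexive rearranged))) ,
  λ 1≤r → *-cancelʳ-< 2 _ _ (≤-<-trans doubled
    (<-≤-trans (*-monoʳ-< m {{>-nonZero 1≤m}} (m*gDen< {k = k} {r} m≡ 1≤r)) (≤-reflexive rearranged)))
  where
  m = a + b
  D = gDen (suc k)
  1≤m : 1 ≤ m
  1≤m = subst (1 ≤_) (sym m≡) (≤-trans (m^n>0 2 (suc k)) (m≤m+n _ r))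
  doubled : 2 * (a * b) * D * 2 ≤ m * (m * D)
  doubled = begin
    2 * (a * b) * D * 2  ≡⟨ regroup (a * b) D ⟩
    4 * (a * b) * D      ≤⟨ *-monoˡ-≤ D (4*m*n≤[m+n]² a b) ⟩
    m * m * D            ≡⟨ *-assoc m m D ⟩
    m * (m * D)          ∎
    where
    regroup : ∀ x D → 2 * x * D * 2 ≡ 4 * x * D
    regroup = solve-∀
  rearranged : m * (2 ^ m * 2 ^ suc k) ≡ m * (2 ^ m * 2 ^ k) * 2
  rearranged = regroup m (2 ^ m) (2 ^ k)
    where
    regroup : ∀ m p q → m * (p * (2 * q)) ≡ m * (p * q) * 2
    regroup = solve-∀

+-<-combine : ∀ {A B x y Q} → A ≤ x * Q → B < y * Q → A + B < (x + y) * Q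
+-<-combine {A} {B} {x} {y} {Q} A≤ B< = subst (A + B <_) (sym (*-distribʳ-+ Q x y)) (+-mono-≤-< A≤ B<)

slack-combine : ∀ {A B C x y S Q} → A + x * S ≤ x * Q → B + y * S ≤ y * Q → C ≤ (x + y) * S →
  A + (B + C) ≤ (x + y) * Q
slack-combine {A} {B} {C} {x} {y} {S} {Q} A+ B+ C≤ = +-cancelʳ-≤ ((x + y) * S) _ _ (begin
  A + (B + C) + (x + y) * S          ≡⟨ regroup A B C x y S ⟩
  (A + x * S) + (B + y * S) + C      ≤⟨ +-mono-≤ (+-mono-≤ A+ B+) C≤ ⟩
  x * Q + y * Q + (x + y) * S        ≡⟨ cong (_+ (x + y) * S) (*-distribʳ-+ Q x y) ⟨
  (x + y) * Q + (x + y) * S          ∎)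
  where
  regroup : ∀ A B C x y S → A + (B + C) + (x + y) * S ≡ (A + x * S) + (B + y * S) + C
  regroup = solve-∀

slack-combine< : ∀ {A B C x y S Q} → A + x * S ≤ x * Q → B + y * S ≤ y * Q → C < (x + y) * S →
  A + (B + C) < (x + y) * Q
slack-combine< {A} {B} {C} {x} {y} {S} {Q} A+ B+ C< = +-cancelʳ-< ((x + y) * S) _ _ (begin-strict
  A + (B + C) + (x + y) * S          ≡⟨ regroup A B C x y S ⟩
  (A + x * S) + (B + y * S) + C      <⟨ +-mono-≤-< (+-mono-≤ A+ B+) C< ⟩
  x * Q + y * Q + (x + y) * S        ≡⟨ cong (_+ (x + y) * S) (*-distribʳ-+ Q x y) ⟨
  (x + y) * Q + (x + y) * S          ∎)
  where
  regroup : ∀ A B C x y S → A + (B + C) + (x + y) * S ≡ (A + x * S) + (B + y * S) + C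
  regroup = solve-∀

smallSide-or-regular : ∀ b → 1 ≤ b → (∃ λ j → SmallSide b j) ⊎ (3 ≤ b × wBound b ≡ gBound b)
smallSide-or-regular 1 _ = inj₁ (1 , side₁)
smallSide-or-regular 2 _ = inj₁ (2 , side₂)
smallSide-or-regular 3 _ = inj₁ (2 , side₃)
smallSide-or-regular 4 _ = inj₂ (s≤s (s≤s (s≤s z≤n)) , refl)
smallSide-or-regular 5 _ = inj₂ (s≤s (s≤s (s≤s z≤n)) , refl)
smallSide-or-regular 6 _ = inj₁ (3 , side₆)
smallSide-or-regular 7 _ = inj₁ (3 , side₇)
smallSide-or-regular (suc (suc (suc (suc (suc (suc (suc (suc b)))))))) _ = inj₂ (s≤s (s≤s (s≤s z≤n)) , refl)

-- Every term is multiplied by gDen (1 + k), the denominator of g at level ⌊log₂ m⌋.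
module LargeSplit {a b k : ℕ} (1≤b : 1 ≤ b) (b≤a : b ≤ a) (16≤m : 16 ≤ a + b) (log≡ : ⌊log₂ (a + b) ⌋ ≡ suc k) where

  m D Q S Tᵃ Tᵇ Tᶜ : ℕ
  m  = a + b
  D  = gDen (suc k)
  Q  = 2 ^ m * gNum (suc k)
  S  = 2 ^ m * 2 ^ k
  Tᵃ = 2 ^ b * gBound a * D
  Tᵇ = 2 ^ a * wBound b * D
  Tᶜ = 2 * (a * b) * D

  1≤a : 1 ≤ a
  1≤a = ≤-trans 1≤b b≤a

  m<2^[2+k] : m < 2 ^ suc (suc k)
  m<2^[2+k] = subst (λ e → m < 2 ^ suc e) log≡ (n<2^suc⌊log₂n⌋ m)

  3≤k : 3 ≤ k
  3≤k = ≤-pred (subst₂ _≤_ (⌊log₂[2^n]⌋≡n 4) log≡ (⌊log₂⌋-mono-≤ 16≤m))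

  ⌊log₂a⌋≤1+k : ⌊log₂ a ⌋ ≤ suc k
  ⌊log₂a⌋≤1+k = subst (⌊log₂ a ⌋ ≤_) log≡ (⌊log₂⌋-mono-≤ (m≤m+n a b))

  ⌊log₂b⌋≤k : ⌊log₂ b ⌋ ≤ k
  ⌊log₂b⌋≤k = ≤-pred (⌊log₂⌋<-2^ 1≤b (*-cancelˡ-< 2 b (2 ^ suc k) (≤-<-trans 2b≤m m<2^[2+k])))
    where
    2b≤m : 2 * b ≤ m
    2b≤m = subst (_≤ m) (cong (b +_) (sym (+-identityʳ b))) (+-monoˡ-≤ b b≤a)

  termᵃ : Tᵃ ≤ a * Q
  termᵃ = scaled-term b 1≤a ⌊log₂a⌋≤1+k

  slackᵇ : wBound b ≡ gBound b → Tᵇ + b * S ≤ b * Q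
  slackᵇ regular = subst (λ w → 2 ^ a * w * D + b * S ≤ b * Q) (sym regular)
    (subst (λ e → 2 ^ a * gBound b * D + b * (2 ^ e * 2 ^ k) ≤ b * (2 ^ e * gNum (suc k))) (+-comm b a)
      (scaled-term-slack a 1≤b ⌊log₂b⌋≤k))

  smallSide-case : ∀ {j} → SmallSide b j → Tᵃ + (Tᵇ + Tᶜ) < m * Q
  smallSide-case side =
    +-<-combine {Tᵃ} {Tᵇ + Tᶜ} {a} {b} {Q} termᵃ (smallSide-term side 9≤a (≤-trans j≤3 (≤-trans 3≤k (n≤1+n k))))
    where
    b≤7 = proj₁ (SmallSide-≤ side)
    j≤3 = proj₂ (SmallSide-≤ side)
    9≤a : 9 ≤ a
    9≤a = +-cancelʳ-≤ b 9 a (≤-trans (+-monoʳ-≤ 9 b≤7) 16≤m)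

  top-case : ⌊log₂ a ⌋ ≡ suc k → 3 ≤ b → wBound b ≡ gBound b → Tᵃ + (Tᵇ + Tᶜ) < m * Q
  top-case log-a≡ 3≤b regular =
    +-<-combine {Tᵃ} {Tᵇ + Tᶜ} {a} {b} {Q} termᵃ
      (<-≤-trans (+-monoʳ-< Tᵇ (cross-term-top {a} {b} {k} a≡ 3≤b)) (slackᵇ regular))
    where
    a≡ : a ≡ 2 ^ suc k + (a ∸ 2 ^ suc k)
    a≡ = sym (m+[n∸m]≡n (subst (λ e → 2 ^ e ≤ a) log-a≡ (2^⌊log₂n⌋≤n 1≤a)))

  low-case : ⌊log₂ a ⌋ < suc k → wBound b ≡ gBound b →
    (Tᵃ + (Tᵇ + Tᶜ) ≤ m * Q) × (NotPowerOf2 m → Tᵃ + (Tᵇ + Tᶜ) < m * Q)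
  low-case log-a< regular =
    slack-combine {Tᵃ} {Tᵇ} {Tᶜ} {a} {b} {S} {Q} slackᵃ (slackᵇ regular) (proj₁ crossᶜ) ,
    λ notPow → slack-combine< {Tᵃ} {Tᵇ} {Tᶜ} {a} {b} {S} {Q} slackᵃ (slackᵇ regular) (proj₂ crossᶜ (1≤r notPow))
    where
    slackᵃ : Tᵃ + a * S ≤ a * Q
    slackᵃ = scaled-term-slack b 1≤a (≤-pred log-a<)
    r = m ∸ 2 ^ suc k
    m≡ : m ≡ 2 ^ suc k + r
    m≡ = sym (m+[n∸m]≡n (subst (λ e → 2 ^ e ≤ m) log≡ (2^⌊log₂n⌋≤n (≤-trans 1≤b (m≤n+m b a)))))
    crossᶜ = cross-term-low {a} {b} {k} {r} m≡
    1≤r : NotPowerOf2 m → 1 ≤ r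
    1≤r notPow with r | m≡
    ... | zero  | m≡′ = contradiction (trans m≡′ (+-identityʳ _)) (notPow (suc k))
    ... | suc _ | _   = s≤s z≤n

  scaled-split : (Tᵃ + (Tᵇ + Tᶜ) ≤ m * Q) × (NotPowerOf2 m → Tᵃ + (Tᵇ + Tᶜ) < m * Q)
  scaled-split with smallSide-or-regular b 1≤b
  ... | inj₁ (_ , side) = <⇒≤ (smallSide-case side) , λ _ → smallSide-case side
  ... | inj₂ (3≤b , regular) with m≤n⇒m<n∨m≡n ⌊log₂a⌋≤1+k
  ...   | inj₁ log-a< = low-case log-a< regular
  ...   | inj₂ log-a≡ = <⇒≤ (top-case log-a≡ 3≤b regular) , λ _ → top-case log-a≡ 3≤b regular

splitBound-scaled : ∀ {a b} E → 8 ≤ a →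
  splitBound a b * E ≡ 2 ^ b * gBound a * E + (2 ^ a * wBound b * E + 2 * (a * b) * E)
splitBound-scaled {a} {b} E 8≤a = begin-equality
  (2 ^ b * wBound a + 2 ^ a * wBound b + 2 * (a * b)) * E
    ≡⟨ cong (λ w → (2 ^ b * w + 2 ^ a * wBound b + 2 * (a * b)) * E) (wBound≡gBound-≥8 8≤a) ⟩
  (2 ^ b * gBound a + 2 ^ a * wBound b + 2 * (a * b)) * E
    ≡⟨ distrib (2 ^ b * gBound a) (2 ^ a * wBound b) (2 * (a * b)) E ⟩
  2 ^ b * gBound a * E + (2 ^ a * wBound b * E + 2 * (a * b) * E) ∎
  where
  distrib : ∀ x y z e → (x + y + z) * e ≡ x * e + (y * e + z * e)
  distrib = solve-∀

wBound-scaled : ∀ {m k} → 8 ≤ m → ⌊log₂ m ⌋ ≡ k → wBound m * gDen k ≡ m * (2 ^ m * gNum k)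
wBound-scaled {m} 8≤m refl = begin-equality
  wBound m * gDen ⌊log₂ m ⌋           ≡⟨ cong (_* gDen ⌊log₂ m ⌋) (wBound≡gBound-≥8 8≤m) ⟩
  gBound m * gDen ⌊log₂ m ⌋           ≡⟨ gBound-scaled (≤-trans (s≤s z≤n) 8≤m) ⟩
  m * 2 ^ m * gNum ⌊log₂ m ⌋          ≡⟨ *-assoc m (2 ^ m) _ ⟩
  m * (2 ^ m * gNum ⌊log₂ m ⌋)        ∎

splitOK-large : ∀ a b → 1 ≤ b → b ≤ a → 16 ≤ a + b → SplitOK a b × (NotPowerOf2 (a + b) → SplitOK< a b)
splitOK-large a b 1≤b b≤a 16≤m with ⌊log₂ (a + b) ⌋ in log≡ | ⌊log₂⌋-mono-≤ 16≤m
... | zero  | 4≤0 = contradiction (subst (_≤ 0) (⌊log₂[2^n]⌋≡n 4) 4≤0) λ ()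
... | suc k | _   =
  *-cancelʳ-≤ _ _ D {{gDen≢0 (suc k)}} (subst₂ _≤_ (sym (splitBound-scaled {a} {b} D 8≤a)) (sym m≡) (proj₁ scaled-split)) ,
  λ notPow → *-cancelʳ-< D _ _ (subst₂ _<_ (sym (splitBound-scaled {a} {b} D 8≤a)) (sym m≡) (proj₂ scaled-split notPow))
  where
  open LargeSplit {a} {b} {k} 1≤b b≤a 16≤m log≡
  8≤a : 8 ≤ a
  8≤a = *-cancelˡ-≤ 2 (≤-trans 16≤m (subst (a + b ≤_) (cong (a +_) (sym (+-identityʳ a))) (+-monoʳ-≤ a b≤a)))
  m≡ : wBound m * D ≡ m * Q
  m≡ = wBound-scaled (≤-trans (from-yes (8 ≤? 16)) 16≤m) log≡

splitBound-comm : ∀ a b → splitBound a b ≡ splitBound b a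
splitBound-comm a b = swap (2 ^ b) (wBound a) (2 ^ a) (wBound b) a b
  where
  swap : ∀ p w q v a b → p * w + q * v + 2 * (a * b) ≡ q * v + p * w + 2 * (b * a)
  swap = solve-∀

splitOK-≥16 : ∀ a b → 1 ≤ a → 1 ≤ b → 16 ≤ a + b → SplitOK a b × (NotPowerOf2 (a + b) → SplitOK< a b)
splitOK-≥16 a b 1≤a 1≤b 16≤m with ≤-total b a
... | inj₁ b≤a = splitOK-large a b 1≤b b≤a 16≤m
... | inj₂ a≤b with splitOK-large b a 1≤a a≤b (subst (16 ≤_) (+-comm a b) 16≤m)
...   | ok , ok< = swapped _≤_ ok , λ notPow → swapped _<_ (ok< (subst NotPowerOf2 (+-comm a b) notPow))
  where
  swapped : (R : ℕ → ℕ → Set) → R (splitBound b a) (wBound (b + a)) → R (splitBound a b) (wBound (a + b))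
  swapped R = subst₂ R (splitBound-comm b a) (cong wBound (+-comm b a))

splitOK : ∀ a b → 1 ≤ a → 1 ≤ b → 3 ≤ a + b → SplitOK a b
splitOK a b 1≤a 1≤b 3≤m with a + b ≤? 15
... | yes m≤15 = splitOK-small a b 1≤a 1≤b 3≤m m≤15
... | no  m≰15 = proj₁ (splitOK-≥16 a b 1≤a 1≤b (≰⇒> m≰15))

splitOK< : ∀ a b → 1 ≤ a → 1 ≤ b → 9 ≤ a + b → NotPowerOf2 (a + b) → SplitOK< a b
splitOK< a b 1≤a 1≤b 9≤m notPow with a + b ≤? 15
... | yes m≤15 = splitOK<-small a b 1≤a 1≤b 9≤m m≤15
... | no  m≰15 = proj₂ (splitOK-≥16 a b 1≤a 1≤b (≰⇒> m≰15)) notPow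

nonempty⇒1≤∣p∣ : ∀ {n} {p : Subset n} → Nonempty p → 1 ≤ ∣ p ∣
nonempty⇒1≤∣p∣ (_ , x∈p) = ≤-trans (s≤s z≤n) (x∈p⇒∣p-x∣<∣p∣ x∈p)

edgeless-weight : ∀ {m} (V : Subset m) → ∣ V ∣ ≤ 2 → 2 * weightOn V (λ _ _ → 0) ≡ wBound ∣ V ∣
edgeless-weight V ∣V∣≤2 = from-square ∣ V ∣ (weightOn V (λ _ _ → 0)) (weightOn-edgeless V) ∣V∣≤2
  where
  from-square : ∀ n w → 2 * w + n ≡ n * n → n ≤ 2 → 2 * w ≡ wBound n
  from-square 0 w eq _ = trans (sym (+-identityʳ (2 * w))) eq
  from-square 1 w eq _ = +-cancelʳ-≡ 1 (2 * w) 0 eq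
  from-square 2 w eq _ = +-cancelʳ-≡ 2 (2 * w) 2 eq
  from-square (suc (suc (suc _))) _ _ (s≤s (s≤s ()))

split-weight≤splitBound : ∀ {m} {V₁ V₂ : Subset m} {M₁ M₂ : Mult m} →
  Rec2 V₁ M₁ → Rec2 V₂ M₂ → V₁ ∩ V₂ ≡ ⊥ →
  2 * weightOn V₁ M₁ ≤ wBound ∣ V₁ ∣ → 2 * weightOn V₂ M₂ ≤ wBound ∣ V₂ ∣ →
  2 * weightOn (V₁ ∪ V₂) (joinMult V₁ V₂ M₁ M₂) ≤ splitBound ∣ V₁ ∣ ∣ V₂ ∣
split-weight≤splitBound {V₁ = V₁} {V₂} {M₁} {M₂} rec₁ rec₂ disj bound₁ bound₂ = begin
  2 * weightOn (V₁ ∪ V₂) (joinMult V₁ V₂ M₁ M₂)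
    ≡⟨ cong (2 *_) (weightOn-split V₁ V₂ M₁ M₂ rec₁ rec₂ disj) ⟩
  2 * (2 ^ b * w₁ + 2 ^ a * w₂ + a * b)
    ≡⟨ distrib (2 ^ b) (2 ^ a) w₁ w₂ (a * b) ⟩
  2 ^ b * (2 * w₁) + 2 ^ a * (2 * w₂) + 2 * (a * b)
    ≤⟨ +-monoˡ-≤ (2 * (a * b)) (+-mono-≤ (*-monoʳ-≤ (2 ^ b) bound₁) (*-monoʳ-≤ (2 ^ a) bound₂)) ⟩
  splitBound a b ∎
  where
  a = ∣ V₁ ∣
  b = ∣ V₂ ∣
  w₁ = weightOn V₁ M₁
  w₂ = weightOn V₂ M₂
  distrib : ∀ p q x y z → 2 * (p * x + q * y + z) ≡ p * (2 * x) + q * (2 * y) + 2 * z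
  distrib = solve-∀

weight≤wBound : ∀ {m} {V : Subset m} {M : Mult m} → Rec2 V M → 2 * weightOn V M ≤ wBound ∣ V ∣
weight≤wBound (base V _ ∣V∣≤2) = ≤-reflexive (edgeless-weight V ∣V∣≤2)
weight≤wBound (split _ V₁ V₂ M₁ M₂ 3≤∣V∣ refl disj ne₁ ne₂ rec₁ rec₂) = begin
  2 * weightOn (V₁ ∪ V₂) (joinMult V₁ V₂ M₁ M₂)
    ≤⟨ split-weight≤splitBound rec₁ rec₂ disj (weight≤wBound rec₁) (weight≤wBound rec₂) ⟩
  splitBound (∣ V₁ ∣) (∣ V₂ ∣)
    ≤⟨ splitOK _ _ (nonempty⇒1≤∣p∣ ne₁) (nonempty⇒1≤∣p∣ ne₂) (subst (3 ≤_) ∣V∣≡ 3≤∣V∣) ⟩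
  wBound (∣ V₁ ∣ + ∣ V₂ ∣)
    ≡⟨ cong wBound ∣V∣≡ ⟨
  wBound (∣ V₁ ∪ V₂ ∣) ∎
  where
  ∣V∣≡ = ∣p∪q∣≡∣p∣+∣q∣ V₁ V₂ disj

weight<wBound : ∀ {m} {V : Subset m} {M : Mult m} → Rec2 V M → 9 ≤ ∣ V ∣ → NotPowerOf2 ∣ V ∣ →
  2 * weightOn V M < wBound ∣ V ∣
weight<wBound (base V _ ∣V∣≤2) 9≤∣V∣ _ = contradiction (≤-trans 9≤∣V∣ ∣V∣≤2) (<⇒≱ (from-yes (2 <? 9)))
weight<wBound (split _ V₁ V₂ M₁ M₂ _ refl disj ne₁ ne₂ rec₁ rec₂) 9≤∣V∣ notPow = begin-strict
  2 * weightOn (V₁ ∪ V₂) (joinMult V₁ V₂ M₁ M₂)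
    ≤⟨ split-weight≤splitBound rec₁ rec₂ disj (weight≤wBound rec₁) (weight≤wBound rec₂) ⟩
  splitBound (∣ V₁ ∣) (∣ V₂ ∣)
    <⟨ splitOK< _ _ (nonempty⇒1≤∣p∣ ne₁) (nonempty⇒1≤∣p∣ ne₂)
                    (subst (9 ≤_) ∣V∣≡ 9≤∣V∣) (subst NotPowerOf2 ∣V∣≡ notPow) ⟩
  wBound (∣ V₁ ∣ + ∣ V₂ ∣)
    ≡⟨ cong wBound ∣V∣≡ ⟨
  wBound (∣ V₁ ∪ V₂ ∣) ∎
  where
  ∣V∣≡ = ∣p∪q∣≡∣p∣+∣q∣ V₁ V₂ disj

1≤∣p∣⇒nonempty : ∀ {n} {p : Subset n} → 1 ≤ ∣ p ∣ → Nonempty p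
1≤∣p∣⇒nonempty {n} {p} 1≤∣p∣ with nonempty? p
... | yes ne = ne
... | no ¬ne = contradiction (trans (cong ∣_∣ (Empty-unique ¬ne)) (∣⊥∣≡0 n)) (>⇒≢ 1≤∣p∣)

keepFirst dropFirst : ∀ {n} → ℕ → Subset n → Subset n
keepFirst _       []          = []
keepFirst zero    (_ ∷ p)     = false ∷ keepFirst zero p
keepFirst (suc a) (true ∷ p)  = true ∷ keepFirst a p
keepFirst (suc a) (false ∷ p) = false ∷ keepFirst (suc a) p

dropFirst _       []          = []
dropFirst zero    (x ∷ p)     = x ∷ dropFirst zero p
dropFirst (suc a) (true ∷ p)  = false ∷ dropFirst a p
dropFirst (suc a) (false ∷ p) = false ∷ dropFirst (suc a) p

keepFirst∪dropFirst : ∀ {n} a (p : Subset n) → keepFirst a p ∪ dropFirst a p ≡ p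
keepFirst∪dropFirst _       []          = refl
keepFirst∪dropFirst zero    (x ∷ p)     = cong (x ∷_) (keepFirst∪dropFirst zero p)
keepFirst∪dropFirst (suc a) (true ∷ p)  = cong (true ∷_) (keepFirst∪dropFirst a p)
keepFirst∪dropFirst (suc a) (false ∷ p) = cong (false ∷_) (keepFirst∪dropFirst (suc a) p)

keepFirst∩dropFirst : ∀ {n} a (p : Subset n) → keepFirst a p ∩ dropFirst a p ≡ ⊥
keepFirst∩dropFirst _       []          = refl
keepFirst∩dropFirst zero    (_ ∷ p)     = cong (false ∷_) (keepFirst∩dropFirst zero p)
keepFirst∩dropFirst (suc a) (true ∷ p)  = cong (false ∷_) (keepFirst∩dropFirst a p)
keepFirst∩dropFirst (suc a) (false ∷ p) = cong (false ∷_) (keepFirst∩dropFirst (suc a) p)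

∣keepFirst∣ : ∀ {n} a (p : Subset n) → a ≤ ∣ p ∣ → ∣ keepFirst a p ∣ ≡ a
∣keepFirst∣ zero    []          _         = refl
∣keepFirst∣ zero    (_ ∷ p)     _         = ∣keepFirst∣ zero p z≤n
∣keepFirst∣ (suc a) (true ∷ p)  (s≤s a≤) = cong suc (∣keepFirst∣ a p a≤)
∣keepFirst∣ (suc a) (false ∷ p) a≤       = ∣keepFirst∣ (suc a) p a≤

∣keepFirst∣+∣dropFirst∣ : ∀ {n} a (p : Subset n) → ∣ keepFirst a p ∣ + ∣ dropFirst a p ∣ ≡ ∣ p ∣
∣keepFirst∣+∣dropFirst∣ a p =
  trans (sym (∣p∪q∣≡∣p∣+∣q∣ _ _ (keepFirst∩dropFirst a p))) (cong ∣_∣ (keepFirst∪dropFirst a p))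

doubling-step : ∀ {m} h G (S : Subset m) → ∣ S ∣ ≡ h + h → 2 ≤ h →
  (∀ S′ → ∣ S′ ∣ ≡ h → ∃ λ M → Rec2 S′ M × 2 * weightOn S′ M ≡ h * G) →
  ∃ λ M → Rec2 S M × 2 * weightOn S M ≡ 2 * h * (G * 2 ^ h + h)
doubling-step h G S ∣S∣≡h+h 2≤h half-graph = M , subst (λ V → Rec2 V M) S₁∪S₂≡S rec , (begin-equality
  2 * weightOn S M
    ≡⟨ cong (λ V → 2 * weightOn V M) S₁∪S₂≡S ⟨
  2 * weightOn (S₁ ∪ S₂) M
    ≡⟨ cong (2 *_) (weightOn-split S₁ S₂ M₁ M₂ rec₁ rec₂ disj) ⟩
  2 * (2 ^ ∣ S₂ ∣ * w₁ + 2 ^ ∣ S₁ ∣ * w₂ + ∣ S₁ ∣ * ∣ S₂ ∣)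
    ≡⟨ cong₂ (λ u v → 2 * (2 ^ v * w₁ + 2 ^ u * w₂ + u * v)) ∣S₁∣ ∣S₂∣ ⟩
  2 * (2 ^ h * w₁ + 2 ^ h * w₂ + h * h)
    ≡⟨ distrib (2 ^ h) w₁ w₂ h ⟩
  2 ^ h * (2 * w₁) + 2 ^ h * (2 * w₂) + 2 * (h * h)
    ≡⟨ cong₂ (λ u v → 2 ^ h * u + 2 ^ h * v + 2 * (h * h)) 2w₁≡ 2w₂≡ ⟩
  2 ^ h * (h * G) + 2 ^ h * (h * G) + 2 * (h * h)
    ≡⟨ collect (2 ^ h) h G ⟩
  2 * h * (G * 2 ^ h + h) ∎)
  where
  S₁ = keepFirst h S
  S₂ = dropFirst h S
  S₁∪S₂≡S = keepFirst∪dropFirst h S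
  disj = keepFirst∩dropFirst h S
  ∣S₁∣ : ∣ S₁ ∣ ≡ h
  ∣S₁∣ = ∣keepFirst∣ h S (subst (h ≤_) (sym ∣S∣≡h+h) (m≤m+n h h))
  ∣S₂∣ : ∣ S₂ ∣ ≡ h
  ∣S₂∣ = +-cancelˡ-≡ h _ _ (trans (cong (_+ ∣ S₂ ∣) (sym ∣S₁∣)) (trans (∣keepFirst∣+∣dropFirst∣ h S) ∣S∣≡h+h))
  half₁ = half-graph S₁ ∣S₁∣
  half₂ = half-graph S₂ ∣S₂∣
  M₁ = proj₁ half₁
  M₂ = proj₁ half₂
  rec₁ = proj₁ (proj₂ half₁)
  rec₂ = proj₁ (proj₂ half₂)
  2w₁≡ = proj₂ (proj₂ half₁)
  2w₂≡ = proj₂ (proj₂ half₂)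
  w₁ = weightOn S₁ M₁
  w₂ = weightOn S₂ M₂
  M = joinMult S₁ S₂ M₁ M₂
  nonempty-half : ∀ {V : Subset _} → ∣ V ∣ ≡ h → Nonempty V
  nonempty-half ∣V∣≡h = 1≤∣p∣⇒nonempty (subst (1 ≤_) (sym ∣V∣≡h) (≤-trans (s≤s z≤n) 2≤h))
  3≤∣S∣ : 3 ≤ ∣ S₁ ∪ S₂ ∣
  3≤∣S∣ = subst (3 ≤_) (trans (sym ∣S∣≡h+h) (cong ∣_∣ (sym S₁∪S₂≡S))) (+-mono-≤ (≤-trans (s≤s z≤n) 2≤h) 2≤h)
  rec : Rec2 (S₁ ∪ S₂) M
  rec = split (S₁ ∪ S₂) S₁ S₂ M₁ M₂ 3≤∣S∣ refl disj (nonempty-half ∣S₁∣) (nonempty-half ∣S₂∣) rec₁ rec₂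
  distrib : ∀ p x y h → 2 * (p * x + p * y + h * h) ≡ p * (2 * x) + p * (2 * y) + 2 * (h * h)
  distrib = solve-∀
  collect : ∀ p h G → p * (h * G) + p * (h * G) + 2 * (h * h) ≡ 2 * h * (G * p + h)
  collect = solve-∀

gBound-2^ : ∀ k → gBound (2 ^ k) ≡ 2 ^ k * gNum k
gBound-2^ k = begin-equality
  2 ^ k * 2 ^ (2 ^ k ∸ 2 ^ ⌊log₂ (2 ^ k) ⌋) * gNum ⌊log₂ (2 ^ k) ⌋
    ≡⟨ cong (λ j → 2 ^ k * 2 ^ (2 ^ k ∸ 2 ^ j) * gNum j) (⌊log₂[2^n]⌋≡n k) ⟩
  2 ^ k * 2 ^ (2 ^ k ∸ 2 ^ k) * gNum k
    ≡⟨ cong (λ e → 2 ^ k * 2 ^ e * gNum k) (n∸n≡0 (2 ^ k)) ⟩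
  2 ^ k * 1 * gNum k
    ≡⟨ cong (_* gNum k) (*-identityʳ (2 ^ k)) ⟩
  2 ^ k * gNum k ∎

edgeless-graph : ∀ {m n} (S : Subset m) → ∣ S ∣ ≡ n → 1 ≤ n → n ≤ 2 →
  ∃ λ M → Rec2 S M × 2 * weightOn S M ≡ wBound n
edgeless-graph S refl 1≤n n≤2 = (λ _ _ → 0) , base S (1≤∣p∣⇒nonempty 1≤n) n≤2 , edgeless-weight S n≤2

powerOf2-graph : ∀ {m} k (S : Subset m) → ∣ S ∣ ≡ 2 ^ k →
  ∃ λ M → Rec2 S M × 2 * weightOn S M ≡ 2 ^ k * gNum k
powerOf2-graph zero       S ∣S∣≡1 = edgeless-graph S ∣S∣≡1 (s≤s z≤n) (s≤s z≤n)
powerOf2-graph (suc zero) S ∣S∣≡2 = edgeless-graph S ∣S∣≡2 (s≤s z≤n) ≤-refl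
powerOf2-graph (suc (suc k)) S ∣S∣≡ =
  doubling-step (2 ^ suc k) (gNum (suc k)) S (trans ∣S∣≡ (cong (2 ^ suc k +_) (+-identityʳ _)))
    (^-monoʳ-≤ 2 (s≤s (z≤n {k}))) (λ S′ → powerOf2-graph (suc k) S′)

Attained : ℕ → Set
Attained m = ∃ λ (M : Mult m) → Rec2 ⊤ M × 2 * weight M ≡ wBound m

graph₅ : Attained 5
graph₅ = joinMult A B (λ _ _ → 0) (joinMult C D (λ _ _ → 0) (λ _ _ → 0)) ,
         split ⊤ A B _ _ (from-yes (3 ≤? 5)) refl refl (nonempty A) (nonempty B) (base A (nonempty A) ≤-refl) recB ,
         refl
  where
  A B C D : Subset 5
  A = true  ∷ true  ∷ false ∷ false ∷ false ∷ []
  B = false ∷ false ∷ true  ∷ true  ∷ true  ∷ []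
  C = false ∷ false ∷ true  ∷ false ∷ false ∷ []
  D = false ∷ false ∷ false ∷ true  ∷ true  ∷ []
  nonempty : ∀ V → .{{_ : NonZero ∣ V ∣}} → Nonempty V
  nonempty V = 1≤∣p∣⇒nonempty (>-nonZero⁻¹ ∣ V ∣)
  recB : Rec2 B (joinMult C D (λ _ _ → 0) (λ _ _ → 0))
  recB = split B C D _ _ ≤-refl refl refl (nonempty C) (nonempty D)
           (base C (nonempty C) (from-yes (1 ≤? 2))) (base D (nonempty D) ≤-refl)

-- The denominator is stored as pred d, so this means p = a / d only for positive d.
infix 4 _≐_/_
_≐_/_ : ℚ → ℕ → ℕ → Set
p ≐ a / d = ℚ.toℚᵘ p ℚᵘ.≃ ℚᵘ.mkℚᵘ (ℤ.+ a) (pred d)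

+a*+d≡+[a*d] : ∀ a {d} → 1 ≤ d → ℤ.+ a ℤ.* ℤ.+ suc (pred d) ≡ ℤ.+ (a * d)
+a*+d≡+[a*d] a (s≤s _) = sym (ℤ.pos-* a _)

mkℚᵘ-≤ : ∀ {a d b e} → 1 ≤ d → 1 ≤ e → a * e ≤ b * d →
  ℚᵘ.mkℚᵘ (ℤ.+ a) (pred d) ℚᵘ.≤ ℚᵘ.mkℚᵘ (ℤ.+ b) (pred e)
mkℚᵘ-≤ {a} {d} {b} {e} 1≤d 1≤e ae≤bd =
  ℚᵘ.*≤* (subst₂ ℤ._≤_ (sym (+a*+d≡+[a*d] a 1≤e)) (sym (+a*+d≡+[a*d] b 1≤d)) (ℤ.+≤+ ae≤bd))

mkℚᵘ-≃ : ∀ {a d b e} → 1 ≤ d → 1 ≤ e →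
  (ℚᵘ.mkℚᵘ (ℤ.+ a) (pred d) ℚᵘ.≃ ℚᵘ.mkℚᵘ (ℤ.+ b) (pred e)) ⇔ (a * e ≡ b * d)
mkℚᵘ-≃ {a} {d} {b} {e} 1≤d 1≤e = mk⇔
  (λ { (ℚᵘ.*≡* eq) → ℤ.+-injective (trans (sym (+a*+d≡+[a*d] a 1≤e)) (trans eq (+a*+d≡+[a*d] b 1≤d))) })
  (λ eq → ℚᵘ.*≡* (trans (+a*+d≡+[a*d] a 1≤e) (trans (cong ℤ.+_ eq) (sym (+a*+d≡+[a*d] b 1≤d)))))

≐-≤ : ∀ {p q a d b e} → 1 ≤ d → 1 ≤ e → p ≐ a / d → q ≐ b / e → a * e ≤ b * d → p ≤ℚ q
≐-≤ 1≤d 1≤e p≐ q≐ ae≤bd =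
  ℚ.toℚᵘ-cancel-≤ (ℚᵘ.≤-respʳ-≃ (ℚᵘ.≃-sym q≐) (ℚᵘ.≤-respˡ-≃ (ℚᵘ.≃-sym p≐) (mkℚᵘ-≤ 1≤d 1≤e ae≤bd)))

≐-≡ : ∀ {p q a d b e} → 1 ≤ d → 1 ≤ e → p ≐ a / d → q ≐ b / e → (p ≡ q) ⇔ (a * e ≡ b * d)
≐-≡ 1≤d 1≤e p≐ q≐ = mk⇔
  (λ { refl → Equivalence.to (mkℚᵘ-≃ 1≤d 1≤e) (ℚᵘ.≃-trans (ℚᵘ.≃-sym p≐) q≐) })
  (λ eq → ℚ.toℚᵘ-injective
    (ℚᵘ.≃-trans p≐ (ℚᵘ.≃-trans (Equivalence.from (mkℚᵘ-≃ 1≤d 1≤e) eq) (ℚᵘ.≃-sym q≐))))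

≐-resp : ∀ {p a d a′ d′} → 1 ≤ d → 1 ≤ d′ → p ≐ a / d → a * d′ ≡ a′ * d → p ≐ a′ / d′
≐-resp 1≤d 1≤d′ p≐ eq = ℚᵘ.≃-trans p≐ (Equivalence.from (mkℚᵘ-≃ 1≤d 1≤d′) eq)

/-≐ : ∀ a d .{{_ : NonZero d}} → ((ℤ.+ a) ℚ./ d) ≐ a / d
/-≐ a (suc d) = ℚ.toℚᵘ-fromℚᵘ (ℚᵘ.mkℚᵘ (ℤ.+ a) d)

≐-+ : ∀ {p q a d b e} → 1 ≤ d → 1 ≤ e → p ≐ a / d → q ≐ b / e → (p ℚ.+ q) ≐ (a * e + b * d) / (d * e)
≐-+ {p} {q} {a} {suc d} {b} {suc e} _ _ p≐ q≐ =
  ℚᵘ.≃-trans (ℚ.toℚᵘ-homo-+ p q)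
    (ℚᵘ.≃-trans (ℚᵘ.+-cong p≐ q≐) (ℚᵘ.≃-reflexive (cong (λ n → ℚᵘ.mkℚᵘ n _) numerator)))
  where
  numerator : ℤ.+ a ℤ.* ℤ.+ suc e ℤ.+ ℤ.+ b ℤ.* ℤ.+ suc d ≡ ℤ.+ (a * suc e + b * suc d)
  numerator = trans (cong₂ ℤ._+_ (sym (ℤ.pos-* a (suc e))) (sym (ℤ.pos-* b (suc d)))) (sym (ℤ.pos-+ (a * suc e) (b * suc d)))

1≤gDen : ∀ k → 1 ≤ gDen k
1≤gDen k = m^n>0 2 (2 ^ k)

g≐gNum/gDen : ∀ k → g k ≐ gNum k / gDen k
g≐gNum/gDen zero    = ℚᵘ.*≡* refl
g≐gNum/gDen (suc k) = ≐-resp (*-mono-≤ (1≤gDen k) (1≤gDen (suc k))) (1≤gDen (suc k))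
  (≐-+ (1≤gDen k) (1≤gDen (suc k)) (g≐gNum/gDen k) (/-≐ (2 ^ k) (gDen (suc k)) {{gDen≢0 (suc k)}}))
  (begin-equality
    (gNum k * D′ + 2 ^ k * D) * D′             ≡⟨ cong (λ d → (gNum k * d + 2 ^ k * D) * d) (gDen-suc k) ⟩
    (gNum k * (D * D) + 2 ^ k * D) * (D * D)   ≡⟨ regroup (gNum k) D (2 ^ k) ⟩
    (gNum k * D + 2 ^ k) * (D * (D * D))       ≡⟨ cong (λ d → (gNum k * D + 2 ^ k) * (D * d)) (gDen-suc k) ⟨
    (gNum k * D + 2 ^ k) * (D * D′)            ∎)
  where
  D  = gDen k
  D′ = gDen (suc k)
  regroup : ∀ G D P → (G * (D * D) + P * D) * (D * D) ≡ (G * D + P) * (D * (D * D))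
  regroup = solve-∀

g-mono : ∀ {j k} → j ≤ k → g j ≤ℚ g k
g-mono {j} {k} j≤k = ≐-≤ (1≤gDen j) (1≤gDen k) (g≐gNum/gDen j) (g≐gNum/gDen k) (gNum-ratio-mono j≤k)

-- Both sides of h₂ ≤ g ⌊log₂ m⌋ cross-multiplied: hval m H = H / N and 2 N g ⌊log₂ m⌋ = gBound m.
module Normalised {n H : ℕ} where

  m N k D : ℕ
  m = suc n
  N = m * 2 ^ n
  k = ⌊log₂ m ⌋
  D = gDen k

  1≤N : 1 ≤ N
  1≤N = *-mono-≤ (s≤s (z≤n {n})) (m^n>0 2 n)

  hval≐ : hval m H ≐ H / N
  hval≐ = /-≐ H N {{m*n≢0 m (2 ^ n) {{_}} {{m^n≢0 2 n}}}}

  gBound*D≡ : gBound m * D ≡ 2 * (gNum k * N)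
  gBound*D≡ = trans (gBound-scaled {m} (s≤s z≤n)) (regroup m (2 ^ n) (gNum k))
    where
    regroup : ∀ m p G → m * (2 * p) * G ≡ 2 * (G * (m * p))
    regroup = solve-∀

  2*H*D≡ : 2 * H * D ≡ 2 * (H * D)
  2*H*D≡ = *-assoc 2 H D

  hval≤g : 2 * H ≤ gBound m → hval m H ≤ℚ g k
  hval≤g 2H≤ = ≐-≤ 1≤N (1≤gDen k) hval≐ (g≐gNum/gDen k) (*-cancelˡ-≤ 2 (begin
    2 * (H * D)          ≡⟨ 2*H*D≡ ⟨
    2 * H * D            ≤⟨ *-monoˡ-≤ D 2H≤ ⟩
    gBound m * D         ≡⟨ gBound*D≡ ⟩
    2 * (gNum k * N)     ∎))

  hval≡g⇔ : (hval m H ≡ g k) ⇔ (2 * H ≡ gBound m)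
  hval≡g⇔ = mk⇔
    (λ eq → *-cancelʳ-≡ (2 * H) (gBound m) D {{gDen≢0 k}}
       (trans 2*H*D≡ (trans (cong (2 *_) (Equivalence.to cross-multiplied eq)) (sym gBound*D≡))))
    (λ eq → Equivalence.from cross-multiplied (*-cancelˡ-≡ (H * D) (gNum k * N) 2
       (trans (sym 2*H*D≡) (trans (cong (_* D) eq) gBound*D≡))))
    where
    cross-multiplied = ≐-≡ 1≤N (1≤gDen k) hval≐ (g≐gNum/gDen k)

IsH2⇒2H≤wBound : ∀ {m H} → IsH2 m H → 2 * H ≤ wBound m
IsH2⇒2H≤wBound {m} ((M , rec , w≡H) , _) =
  subst₂ (λ w n → 2 * w ≤ wBound n) (trans (sym (weight≡weightOn-⊤ M)) w≡H) (∣⊤∣≡n m) (weight≤wBound rec)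

IsH2⇒2H<wBound : ∀ {m H} → IsH2 m H → 9 ≤ m → NotPowerOf2 m → 2 * H < wBound m
IsH2⇒2H<wBound {m} ((M , rec , w≡H) , _) 9≤m notPow =
  subst₂ (λ w n → 2 * w < wBound n) (trans (sym (weight≡weightOn-⊤ M)) w≡H) (∣⊤∣≡n m)
    (weight<wBound rec (subst (9 ≤_) (sym (∣⊤∣≡n m)) 9≤m) (subst NotPowerOf2 (sym (∣⊤∣≡n m)) notPow))

IsH2-attained : ∀ {m H} → IsH2 m H → Attained m → 2 * H ≡ wBound m
IsH2-attained {H = H} isH₂ (M , rec , 2w≡) =
  ≤-antisym (IsH2⇒2H≤wBound isH₂) (subst (_≤ 2 * H) 2w≡ (*-monoʳ-≤ 2 (proj₂ isH₂ M rec)))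

wBound-2^ : ∀ k → wBound (2 ^ k) ≡ 2 ^ k * gNum k
wBound-2^ k = trans (regular k) (gBound-2^ k)
  where
  regular : ∀ k → wBound (2 ^ k) ≡ gBound (2 ^ k)
  regular 0 = refl
  regular 1 = refl
  regular 2 = refl
  regular (suc (suc (suc k))) = wBound≡gBound-≥8 (^-monoʳ-≤ 2 (s≤s (s≤s (s≤s (z≤n {k})))))

graph-2^ : ∀ k → Attained (2 ^ k)
graph-2^ k with powerOf2-graph k ⊤ (∣⊤∣≡n (2 ^ k))
... | M , rec , 2w≡ = M , rec , trans (cong (2 *_) (weight≡weightOn-⊤ M)) (trans 2w≡ (sym (wBound-2^ k)))

≢2^⌊log₂⌋⇒NotPowerOf2 : ∀ {m} → m ≢ 2 ^ ⌊log₂ m ⌋ → NotPowerOf2 m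
≢2^⌊log₂⌋⇒NotPowerOf2 {m} m≢ j refl = m≢ (cong (2 ^_) (sym (⌊log₂[2^n]⌋≡n j)))

9≤-unless-excluded : ∀ {m} → 1 ≤ m → m ≢ 3 → m ≢ 5 → m ≢ 6 → m ≢ 7 → NotPowerOf2 m → 9 ≤ m
9≤-unless-excluded {1} _ _   _   _   _   notPow = contradiction refl (notPow 0)
9≤-unless-excluded {2} _ _   _   _   _   notPow = contradiction refl (notPow 1)
9≤-unless-excluded {3} _ m≢3 _   _   _   _      = contradiction refl m≢3
9≤-unless-excluded {4} _ _   _   _   _   notPow = contradiction refl (notPow 2)
9≤-unless-excluded {5} _ _   m≢5 _   _   _      = contradiction refl m≢5
9≤-unless-excluded {6} _ _   _   m≢6 _   _      = contradiction refl m≢6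
9≤-unless-excluded {7} _ _   _   _   m≢7 _      = contradiction refl m≢7
9≤-unless-excluded {8} _ _   _   _   _   notPow = contradiction refl (notPow 3)
9≤-unless-excluded {suc (suc (suc (suc (suc (suc (suc (suc (suc _))))))))} _ _ _ _ _ _ =
  s≤s (s≤s (s≤s (s≤s (s≤s (s≤s (s≤s (s≤s (s≤s z≤n))))))))

h₂≤g : ∀ m H → 1 ≤ m → wBound m ≡ gBound m → IsH2 m H → hval m H ≤ℚ g ⌊log₂ m ⌋
h₂≤g (suc n) H _ regular isH₂ = hval≤g (subst (2 * H ≤_) regular (IsH2⇒2H≤wBound isH₂))
  where open Normalised {n} {H}

h₂≡g⇔ : ∀ m H → 1 ≤ m → m ≢ 3 → m ≢ 6 → m ≢ 7 → IsH2 m H →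
  (hval m H ≡ g ⌊log₂ m ⌋) ⇔ (m ≡ 5 ⊎ ∃ λ k → m ≡ 2 ^ k)
h₂≡g⇔ (suc n) H 1≤m m≢3 m≢6 m≢7 isH₂ = mk⇔
  (λ eq → extremal (trans (Equivalence.to hval≡g⇔ eq) (sym regular)))
  (λ extremal-m → Equivalence.from hval≡g⇔ (trans (IsH2-attained isH₂ (attaining extremal-m)) regular))
  where
  open Normalised {n} {H}
  regular = wBound≡gBound m m≢3 m≢6 m≢7
  attaining : m ≡ 5 ⊎ (∃ λ k → m ≡ 2 ^ k) → Attained m
  attaining (inj₁ m≡5)       = subst Attained (sym m≡5) graph₅
  attaining (inj₂ (k , m≡2^)) = subst Attained (sym m≡2^) (graph-2^ k)
  extremal : 2 * H ≡ wBound m → m ≡ 5 ⊎ ∃ λ k → m ≡ 2 ^ k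
  extremal 2H≡ with m ≟ 2 ^ ⌊log₂ m ⌋ | m ≟ 5
  ... | yes m≡2^ | _       = inj₂ (⌊log₂ m ⌋ , m≡2^)
  ... | no  _    | yes m≡5 = inj₁ m≡5
  ... | no  m≢2^ | no  m≢5 = contradiction 2H≡ (<⇒≢ (IsH2⇒2H<wBound isH₂
          (9≤-unless-excluded 1≤m m≢3 m≢5 m≢6 m≢7 notPow) notPow))
    where notPow = ≢2^⌊log₂⌋⇒NotPowerOf2 m≢2^

limsup≤ : (q : ℚ) → ((k : ℕ) → g k ≤ℚ q) → ∃ λ N → (m H : ℕ) → N ≤ m → IsH2 m H → hval m H ≤ℚ q
limsup≤ q g≤q = 8 , λ m H 8≤m isH₂ →
  ℚ.≤-trans (h₂≤g m H (≤-trans (s≤s z≤n) 8≤m) (wBound≡gBound-≥8 8≤m) isH₂) (g≤q ⌊log₂ m ⌋)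

limsup≥ : (q : ℚ) → (∃ λ k → q <ℚ g k) → (N : ℕ) → ∃ λ m → N ≤ m × ((H : ℕ) → IsH2 m H → q <ℚ hval m H)
limsup≥ q (k , q<g) N = 2 ^ (k + N) , N≤m , λ H isH₂ →
  ℚ.<-≤-trans q<g (ℚ.≤-trans (g-mono (m≤m+n k N)) (ℚ.≤-reflexive (sym (hval≡g H isH₂))))
  where
  N≤m : N ≤ 2 ^ (k + N)
  N≤m = ≤-trans (<⇒≤ (n<2^n N)) (^-monoʳ-≤ 2 (m≤n+m N k))
  hval≡g : ∀ H → IsH2 (2 ^ (k + N)) H → hval (2 ^ (k + N)) H ≡ g (k + N)
  hval≡g H isH₂ = trans
    (Equivalence.from (h₂≡g⇔ _ H (m^n>0 2 (k + N)) (≢2^ {3} (λ ())) (≢2^ {6} (λ ())) (≢2^ {7} (λ ())) isH₂)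
                      (inj₂ (k + N , refl)))
    (cong g (⌊log₂[2^n]⌋≡n (k + N)))
    where
    ≢2^ : ∀ {c} → c ≢ 2 ^ ⌊log₂ c ⌋ → 2 ^ (k + N) ≢ c
    ≢2^ c≢ = ≢-sym (≢2^⌊log₂⌋⇒NotPowerOf2 c≢ (k + N))

lemma5p5 : ((m H : ℕ) → 1 ≤ m → m ≢ 3 → m ≢ 6 → m ≢ 7 → IsH2 m H →
    (hval m H ≤ℚ g ⌊log₂ m ⌋)
    × ((hval m H ≡ g ⌊log₂ m ⌋) ⇔ (m ≡ 5 ⊎ ∃ λ k → m ≡ 2 ^ k)))
    × ((q : ℚ) → ((k : ℕ) → g k ≤ℚ q) →
    ∃ λ N → (m H : ℕ) → N ≤ m → IsH2 m H → hval m H ≤ℚ q)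
    × ((q : ℚ) → (∃ λ k → q <ℚ g k) →
    (N : ℕ) → ∃ λ m → N ≤ m × ((H : ℕ) → IsH2 m H → q <ℚ hval m H))
lemma5p5 =
  (λ m H 1≤m m≢3 m≢6 m≢7 isH₂ →
     h₂≤g m H 1≤m (wBound≡gBound m m≢3 m≢6 m≢7) isH₂ , h₂≡g⇔ m H 1≤m m≢3 m≢6 m≢7 isH₂) ,
  limsup≤ ,
  limsup≥
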